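{- Let $(W,S)$ be a finite Coxeter system and $\theta:W\to W$ a group automorphism with $\theta^2=\mathrm{id}$ and $\theta(S)=S$. The $h$-polynomial of $\Delta_\theta$ equals \[ \mathrm{des}_\theta(x)=\sum_{w\in\mathfrak{I}(\theta)}x^{|D_R(w)|}. \]
   Context: $\ell$ is the length function, $D_R(w)=\{s\in S\mid \ell(ws)<\ell(w)\}$, and $\mathfrak{I}(\theta)=\{w\in W\mid \theta(w)=w^{ -1}\}$. For $s\in S$, $\underline{s}$ acts on the right on $W$ by $w\underline{s}=ws$ if $\theta(s)ws=w$, and $w\underline{s}=\theta(s)ws$ otherwise; this preserves $\mathfrak{I}(\theta)$. Let $G_\theta$ be the edge-labelled graph on vertex set $\mathfrak{I}(\theta)$ with an edge labelled $s$ between $v$ and $w$ whenever $v\underline{s}=w$. For $J\subseteq S$ and $w\in\mathfrak{I}(\theta)$, $wC_J$ is the connected component containing $w$ of the subgraph of $G_\theta$ keeping only edges with labels in $J$ (as a labelled graph). The set $P_\theta=\{wC_J\}$ ordered by reverse inclusion of labelled subgraphs is the face poset of a pure Boolean cell complex $\Delta_\theta$ of dimension $d=|S|-1$, in which $wC_J$ is a cell of dimension $|S|-|J|-1$ (and $G_\theta=wC_S$ is the empty cell of dimension $-1$). If $f_i$ is the number of $i$-dimensional cells ($f_{ -1}=1$), the $f$-polynomial is $f(x)=\sum_{i\geq0}f_{i-1}x^i$ and the $h$-polynomial is $h(x)=(1-x)^{d+1}f\!\left(\frac{x}{1-x}\right)$. -}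

module Defs where

open import Level using (0ℓ)
open import Data.Nat as ℕ using (ℕ; zero; suc; _∸_; _<_; _≤_; _<?_)
open import Data.Integer as ℤ using (ℤ)
open import Data.Nat.ListAction using (sum)
open import Data.Fin using (Fin)
open import Data.Fin.Subset using (Subset; _∈_; ∣_∣; inside; outside)
open import Data.Vec using (_∷_; [])
open import Data.List as List using (List; []; _∷_; length; map; filter; foldr; allFin; upTo)
open import Data.List.Relation.Unary.Any using (Any)
open import Data.List.Relation.Unary.AllPairs using (AllPairs)
open import Data.Product using (Σ; ∃; _×_; _,_)
open import Data.Sum using (_⊎_)
open import Relation.Nullary using (¬_; Dec; yes; no)
open import Relation.Binary using (Decidable)
open import Relation.Binary.PropositionalEquality using (_≡_)
open import Function.Bundles using (_⇔_)
open import Algebra.Bundles using (Group; RawGroup)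
open import Algebra.Morphism.Structures using (module GroupMorphisms)

-- Polynomials with integer coefficients as coefficient lists
-- (constant term first).

Poly : Set
Poly = List ℤ

coeff : Poly → ℕ → ℤ
coeff []       _       = ℤ.0ℤ
coeff (a ∷ p)  zero    = a
coeff (a ∷ p)  (suc k) = coeff p k

_+ₚ_ : Poly → Poly → Poly
[]      +ₚ q       = q
p       +ₚ []      = p
(a ∷ p) +ₚ (b ∷ q) = (a ℤ.+ b) ∷ (p +ₚ q)

scale : ℤ → Poly → Poly
scale c = map (c ℤ.*_)

_*ₚ_ : Poly → Poly → Poly
[]      *ₚ q = []
(a ∷ p) *ₚ q = scale a q +ₚ (ℤ.0ℤ ∷ (p *ₚ q))

constₚ : ℤ → Poly
constₚ c = c ∷ []

Xₚ : Poly
Xₚ = ℤ.0ℤ ∷ ℤ.1ℤ ∷ []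

_^ₚ_ : Poly → ℕ → Poly
p ^ₚ zero  = constₚ ℤ.1ℤ
p ^ₚ suc k = p *ₚ (p ^ₚ k)

sumₚ : List Poly → Poly
sumₚ = foldr _+ₚ_ []

oneMinusX : Poly
oneMinusX = ℤ.1ℤ ∷ ℤ.-1ℤ ∷ []

_≈ₚ_ : Poly → Poly → Set
p ≈ₚ q = ∀ k → coeff p k ≡ coeff q k

allSubsets : (n : ℕ) → List (Subset n)
allSubsets zero    = [] ∷ []
allSubsets (suc n) = map (inside ∷_) (allSubsets n) List.++ map (outside ∷_) (allSubsets n)

module _ (W : Group 0ℓ 0ℓ) where
  open Group W

  wordProd : {n : ℕ} → (Fin n → Carrier) → List (Fin n) → Carrier
  wordProd S = foldr (λ i x → S i ∙ x) ε

  pow : Carrier → ℕ → Carrier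
  pow g zero    = ε
  pow g (suc k) = g ∙ pow g k

-- A (finite) Coxeter system (W,S) with S = {S i | i : Fin n}:
-- S is a set of n distinct involutions generating W, and W is presented by
-- the Coxeter relations, i.e. it has the universal property of the group
-- < S | (s t)^k for all s,t in S and k with (st)^k = 1 in W >
-- (these relations generate the same normal subgroup as (st)^{m(s,t)}).
record IsCoxeterSystem (W : Group 0ℓ 0ℓ) (n : ℕ) (S : Fin n → Group.Carrier W) : Set₁ where
  open Group W
  field
    gen-inj      : ∀ i j → S i ≈ S j → i ≡ j
    gen-nontriv  : ∀ i → ¬ (S i ≈ ε)
    gen-invol    : ∀ i → S i ∙ S i ≈ ε
    generates    : ∀ w → ∃ λ (u : List (Fin n)) → wordProd W S u ≈ w
    universal    : (G : Group 0ℓ 0ℓ) (f : Fin n → Group.Carrier G) →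
                   (∀ i j k → pow W (S i ∙ S j) k ≈ ε →
                      Group._≈_ G (pow G (Group._∙_ G (f i) (f j)) k) (Group.ε G)) →
                   ∃ λ (h : Carrier → Group.Carrier G) →
                     GroupMorphisms.IsGroupHomomorphism (Group.rawGroup W) (Group.rawGroup G) h ×
                     (∀ i → Group._≈_ G (h (S i)) (f i))

record IsFiniteEnum (W : Group 0ℓ 0ℓ) (elems : List (Group.Carrier W)) : Set where
  open Group W
  field
    complete : ∀ w → Any (w ≈_) elems
    distinct : AllPairs (λ a b → ¬ (a ≈ b)) elems

record IsLengthFunction (W : Group 0ℓ 0ℓ) (n : ℕ) (S : Fin n → Group.Carrier W)
                        (ℓ : Group.Carrier W → ℕ) : Set where
  open Group W
  field
    attained : ∀ w → ∃ λ (u : List (Fin n)) → (length u ≡ ℓ w) × (wordProd W S u ≈ w)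
    minimal  : ∀ w (u : List (Fin n)) → wordProd W S u ≈ w → ℓ w ≤ length u

record IsInvolutiveDiagramAut (W : Group 0ℓ 0ℓ) (n : ℕ) (S : Fin n → Group.Carrier W)
                              (θ : Group.Carrier W → Group.Carrier W) : Set where
  open Group W
  field
    homo       : GroupMorphisms.IsGroupHomomorphism (Group.rawGroup W) (Group.rawGroup W) θ
    involutive : ∀ w → θ (θ w) ≈ w
    preservesS : ∀ i → ∃ λ j → θ (S i) ≈ S j

module Construction (W : Group 0ℓ 0ℓ) (_≈?_ : Decidable (Group._≈_ W))
                    (n : ℕ) (S : Fin n → Group.Carrier W)
                    (θ : Group.Carrier W → Group.Carrier W)
                    (ℓ : Group.Carrier W → ℕ) where
  open Group W

  InI : Carrier → Set
  InI w = θ w ≈ w ⁻¹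

  act : Carrier → Fin n → Carrier
  act w i with (θ (S i) ∙ w ∙ S i) ≈? w
  ... | yes _ = w ∙ S i
  ... | no  _ = θ (S i) ∙ w ∙ S i

  Edge : Subset n → Carrier → Carrier → Set
  Edge J v w = ∃ λ i → i ∈ J × (act v i ≈ w ⊎ act w i ≈ v)

  data Reach (J : Subset n) : Carrier → Carrier → Set where
    here : ∀ {v w} → v ≈ w → Reach J v w
    step : ∀ {v u w} → Edge J v u → Reach J u w → Reach J v w

  -- c is the number of connected components of the subgraph of G_θ
  -- (vertex set 𝔍(θ)) keeping only the edges with labels in J:
  -- there is a labelling of the vertices by Fin c, onto, whose fibres are
  -- exactly the components.
  IsComponentCount : Subset n → ℕ → Set
  IsComponentCount J c =
    Σ (Carrier → Fin c) λ φ →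
      (∀ v w → InI v → InI w → (φ v ≡ φ w ⇔ Reach J v w)) ×
      (∀ k → ∃ λ v → InI v × (φ v ≡ k))

  -- f-polynomial and h-polynomial of Δ_θ from the component counts:
  -- cells of dimension i-1 are the components wC_J with |J| = n - i,
  -- so f_{i-1} = Σ_{|J| = n-i} comp J.
  fvec : (Subset n → ℕ) → ℕ → ℕ
  fvec comp i = sum (map comp (filter (λ J → ∣ J ∣ ℕ.≟ (n ∸ i)) (allSubsets n)))

  -- f(x) = Σ_{i=0}^{n} f_{i-1} x^i, d + 1 = n, and
  -- h(x) = (1-x)^n f(x/(1-x)) = Σ_{i=0}^{n} f_{i-1} x^i (1-x)^{n-i}
  hPoly : (Subset n → ℕ) → Poly
  hPoly comp = sumₚ (map (λ i → constₚ (ℤ.+ fvec comp i) *ₚ ((Xₚ ^ₚ i) *ₚ (oneMinusX ^ₚ (n ∸ i))))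
                         (upTo (suc n)))

  descents : Carrier → ℕ
  descents w = length (filter (λ i → ℓ (w ∙ S i) <? ℓ w) (allFin n))

  desPoly : List Carrier → Poly
  desPoly elems = sumₚ (map (λ w → Xₚ ^ₚ descents w)
                            (filter (λ w → θ w ≈? (w ⁻¹)) elems))

module Submission where

-- Each component of the J-subgraph of G_θ contains exactly one twisted involution w with
-- D_R(w) ∩ J = ∅. Existence: if s ∈ J is a right descent of w, the edge from w to w s̲ leads to a
-- shorter twisted involution. Uniqueness: a component lies in the double coset W_θ(J) w W_J, a twisted
-- involution without right descents in J has no left descents in θ(J), and Deodhar's lemma together
-- with the additivity ℓ(x b) = ℓ(x) + ℓ(b) for x without right descents in J and b ∈ W_J make such an
-- element the unique element of minimal length of its double coset. Writing c(J) for the number of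
-- components and counting pairs (J, w) gives
--   h(x) = Σ_J c(J) x^(n-|J|) (1-x)^|J| = Σ_w Σ_{J ∩ D_R(w) = ∅} x^(n-|J|) (1-x)^|J| = Σ_w x^|D_R(w)|.
-- The exchange condition behind all of this is derived from the Coxeter presentation through Tits'
-- permutation representation of W on W × {±1}.

open import Defs
open import Level using (0ℓ)
open import Algebra.Bundles using (Group)
open import Algebra.Morphism.Structures using (module GroupMorphisms)
open import Data.Bool using (Bool; true; false; if_then_else_; not; _∧_; _xor_; T)
open import Data.Bool.Properties using (xor-assoc; xor-same; xor-identityʳ)
open import Data.Empty using (⊥-elim)
open import Data.Fin using (Fin; zero; suc; toℕ) renaming (_<_ to _<ᶠ_)
import Data.Fin.Properties as Fin
open import Data.Fin.Subset using (Subset; _∈_; ∣_∣; inside; outside)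
open import Data.Fin.Subset.Properties using (∣p∣≤n; _∈?_)
import Data.Integer as ℤ
import Data.Integer.Properties as ℤ
open import Data.Integer.Tactic.RingSolver using (solve-∀)
open import Data.List using (List; []; _∷_; _++_; _∷ʳ_; length; map; filter; reverse; lookup; tabulate; upTo)
import Data.List.Properties as List
open import Data.List.Membership.Propositional using () renaming (_∈_ to _∈ₗ_)
import Data.List.Membership.Propositional as Mem
import Data.List.Membership.Propositional.Properties as Mem
open import Data.List.Relation.Unary.All as All using (All; []; _∷_)
open import Data.List.Relation.Unary.All.Properties using (++⁺; ++⁻ˡ; ++⁻ʳ)
open import Data.List.Relation.Unary.AllPairs using (AllPairs; []; _∷_)
import Data.List.Relation.Unary.AllPairs.Properties as AllPairs
import Data.List.Relation.Unary.Any as Any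
import Data.List.Relation.Unary.Any.Properties as Any
open import Data.List.Reverse using (Reverse; []; _∶_∶ʳ_; reverseView)
open import Data.Nat as ℕ using (ℕ; zero; suc; _∸_; _≤_; _<_; _<?_; s≤s)
import Data.Nat.Induction as ℕ
import Data.Nat.Properties as ℕ
open import Data.Nat.GeneralisedArithmetic using (fold; iterate-is-fold)
open import Data.Nat.ListAction using (sum)
open import Data.Product using (∃-syntax; _×_; _,_; proj₁; proj₂)
open import Data.Product.Relation.Binary.Pointwise.NonDependent using (_×ₛ_)
open import Data.Sum using (_⊎_; inj₁; inj₂)
open import Data.Unit using (tt)
open import Data.Vec as Vec using ([]; _∷_; here; there)
open import Function using (_∘_)
open import Function.Bundles using (_⇔_; mk⇔; Equivalence)
open import Induction.WellFounded using (Acc; acc)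
open import Relation.Binary using (Setoid; Decidable; Tri; tri<; tri≈; tri>)
import Relation.Binary.PropositionalEquality as ≡
open ≡ using (_≡_; _≗_)
open import Relation.Nullary using (¬_; yes; no; does; contradiction)
open import Relation.Nullary.Decidable using (T?; dec-true; dec-false; does-⇔; _×-dec_)
open import Relation.Unary as U using (Pred)

disjoint : ∀ {n} → Subset n → Subset n → Bool
disjoint []      []      = true
disjoint (a ∷ J) (d ∷ D) = not (a ∧ d) ∧ disjoint J D

module HPolynomial where
  open import Data.Integer using (ℤ; 0ℤ; 1ℤ; _+_; _*_; _-_)
  open ≡ using (refl; sym; trans; cong; cong₂; cong-app; module ≡-Reasoning)

  Seq : Set
  Seq = ℕ → ℤ

  infixr 8 x·_ [1-x]·_ x^_·_ [1-x]^_·_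

  x·_ : Seq → Seq
  (x· g) zero    = 0ℤ
  (x· g) (suc k) = g k

  [1-x]·_ : Seq → Seq
  ([1-x]· g) k = g k - (x· g) k

  x^_·_ : ℕ → Seq → Seq
  x^ m · g = fold g x·_ m

  [1-x]^_·_ : ℕ → Seq → Seq
  [1-x]^ m · g = fold g [1-x]·_ m

  δ₀ : Seq
  δ₀ = coeff (constₚ 1ℤ)

  x·-cong : ∀ {f g} → f ≗ g → x· f ≗ x· g
  x·-cong f≗g zero    = refl
  x·-cong f≗g (suc k) = f≗g k

  [1-x]·-cong : ∀ {f g} → f ≗ g → [1-x]· f ≗ [1-x]· g
  [1-x]·-cong f≗g k = cong₂ _-_ (f≗g k) (x·-cong f≗g k)

  fold-cong : ∀ {s : Seq → Seq} → (∀ {f g} → f ≗ g → s f ≗ s g) →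
              ∀ m {f g} → f ≗ g → fold f s m ≗ fold g s m
  fold-cong s-cong zero    f≗g = f≗g
  fold-cong s-cong (suc m) f≗g = s-cong (fold-cong s-cong m f≗g)

  fold-suc : ∀ {A : Set} (z : A) (s : A → A) m → fold z s (suc m) ≡ fold (s z) s m
  fold-suc z s m = trans (iterate-is-fold z s (suc m)) (sym (iterate-is-fold (s z) s m))

  x^-cong : ∀ m {f g} → f ≗ g → x^ m · f ≗ x^ m · g
  x^-cong = fold-cong x·-cong

  x^-linear : ∀ m f g → x^ m · (λ k → f k - g k) ≗ λ k → (x^ m · f) k - (x^ m · g) k
  x^-linear zero    f g k       = refl
  x^-linear (suc m) f g zero    = refl
  x^-linear (suc m) f g (suc k) = x^-linear m f g k

  ∑ : {A : Set} → List A → (A → ℤ) → ℤ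
  ∑ []       f = 0ℤ
  ∑ (x ∷ xs) f = f x + ∑ xs f

  syntax ∑ xs (λ x → e) = ∑[ x ∈ xs ] e

  private variable A B : Set


  ∑-cong : ∀ (xs : List A) {f g} → (∀ x → f x ≡ g x) → ∑ xs f ≡ ∑ xs g
  ∑-cong []       f≡g = refl
  ∑-cong (x ∷ xs) f≡g = cong₂ _+_ (f≡g x) (∑-cong xs f≡g)

  ∑-zero : ∀ (xs : List A) → ∑[ x ∈ xs ] 0ℤ ≡ 0ℤ
  ∑-zero []       = refl
  ∑-zero (x ∷ xs) = trans (ℤ.+-identityˡ _) (∑-zero xs)

  ∑-++ : ∀ (xs ys : List A) f → ∑ (xs ++ ys) f ≡ ∑ xs f + ∑ ys f
  ∑-++ []       ys f = sym (ℤ.+-identityˡ _)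
  ∑-++ (x ∷ xs) ys f = trans (cong (f x +_) (∑-++ xs ys f)) (sym (ℤ.+-assoc (f x) _ _))

  ∑-map : ∀ (g : A → B) (xs : List A) f → ∑ (map g xs) f ≡ ∑[ x ∈ xs ] f (g x)
  ∑-map g []       f = refl
  ∑-map g (x ∷ xs) f = cong (f (g x) +_) (∑-map g xs f)

  ∑-+ : ∀ (xs : List A) f g → ∑[ x ∈ xs ] (f x + g x) ≡ ∑ xs f + ∑ xs g
  ∑-+ []       f g = refl
  ∑-+ (x ∷ xs) f g = trans (cong (f x + g x +_) (∑-+ xs f g)) (swap-middle (f x) (g x) _ _)
    where
    swap-middle : ∀ a b c d → a + b + (c + d) ≡ a + c + (b + d)
    swap-middle = solve-∀

  ∑-*ʳ : ∀ (xs : List A) f c → ∑ xs f * c ≡ ∑[ x ∈ xs ] (f x * c)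
  ∑-*ʳ []       f c = ℤ.*-zeroˡ c
  ∑-*ʳ (x ∷ xs) f c = trans (ℤ.*-distribʳ-+ c (f x) (∑ xs f)) (cong (f x * c +_) (∑-*ʳ xs f c))

  ∑-comm : ∀ (xs : List A) (ys : List B) (f : A → B → ℤ) →
           ∑[ x ∈ xs ] ∑[ y ∈ ys ] f x y ≡ ∑[ y ∈ ys ] ∑[ x ∈ xs ] f x y
  ∑-comm []       ys f = sym (∑-zero ys)
  ∑-comm (x ∷ xs) ys f =
    trans (cong (∑ ys (f x) +_) (∑-comm xs ys f)) (sym (∑-+ ys (f x) _))

  ∑-filter : ∀ {P : Pred A 0ℓ} (P? : U.Decidable P) (c : A → ℕ) (xs : List A) →
             ℤ.+ sum (map c (filter P? xs)) ≡ ∑[ x ∈ xs ] (if does (P? x) then ℤ.+ c x else 0ℤ)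
  ∑-filter P? c []       = refl
  ∑-filter P? c (x ∷ xs) with does (P? x)
  ... | true  = trans (ℤ.pos-+ (c x) _) (cong (ℤ.+ c x +_) (∑-filter P? c xs))
  ... | false = trans (∑-filter P? c xs) (sym (ℤ.+-identityˡ _))

  ∑-count : ∀ {P : Pred A 0ℓ} (P? : U.Decidable P) (xs : List A) →
            ℤ.+ length (filter P? xs) ≡ ∑[ x ∈ xs ] (if does (P? x) then 1ℤ else 0ℤ)
  ∑-count P? []       = refl
  ∑-count P? (x ∷ xs) with does (P? x)
  ... | true  = trans (ℤ.pos-+ 1 _) (cong (1ℤ +_) (∑-count P? xs))
  ... | false = trans (∑-count P? xs) (sym (ℤ.+-identityˡ _))

  ∑-x· : ∀ (xs : List A) (b : A → Bool) (H : A → Seq) k →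
         ∑[ x ∈ xs ] (if b x then (x· H x) k else 0ℤ) ≡
         (x· λ k′ → ∑[ x ∈ xs ] (if b x then H x k′ else 0ℤ)) k
  ∑-x· xs b H zero    = trans (∑-cong xs (λ x → if-zero (b x))) (∑-zero xs)
    where
    if-zero : ∀ c → (if c then 0ℤ else 0ℤ) ≡ 0ℤ
    if-zero true  = refl
    if-zero false = refl
  ∑-x· xs b H (suc k) = refl

  if-*ʳ : ∀ b x c → (if b then x else 0ℤ) * c ≡ (if b then x * c else 0ℤ)
  if-*ʳ true  x c = refl
  if-*ʳ false x c = ℤ.*-zeroˡ c

  ∑-upTo-unique : ∀ (g : ℕ → ℤ) {P : Pred ℕ 0ℓ} (P? : U.Decidable P) j N →
                  (∀ {i} → i < N → P i ⇔ j ≡ i) →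
                  ∑[ i ∈ upTo N ] (if does (P? i) then g i else 0ℤ) ≡
                  (if does (j ℕ.<? N) then g j else 0ℤ)
  ∑-upTo-unique g P? j zero    _     = refl
  ∑-upTo-unique g P? j (suc N) P⇔≡j = begin
    ∑ (upTo (suc N)) f                   ≡⟨ cong (λ xs → ∑ xs f) (sym (List.upTo-∷ʳ N)) ⟩
    ∑ (upTo N ++ N ∷ []) f               ≡⟨ ∑-++ (upTo N) (N ∷ []) f ⟩
    ∑ (upTo N) f + (f N + 0ℤ)            ≡⟨ cong₂ _+_ (∑-upTo-unique g P? j N (P⇔≡j ∘ <-step))
                                                      (ℤ.+-identityʳ (f N)) ⟩
    term N + f N                      ≡⟨ last-term (ℕ.<-cmp j N) ⟩
    (if does (j ℕ.<? suc N) then g j else 0ℤ) ∎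
    where
    open ≡-Reasoning
    f : ℕ → ℤ
    f i = if does (P? i) then g i else 0ℤ
    term : ℕ → ℤ
    term M = if does (j ℕ.<? M) then g j else 0ℤ
    <-step : ∀ {i} → i < N → i < suc N
    <-step = ℕ.m<n⇒m<1+n
    last-term : Tri (j < N) (j ≡ N) (N < j) → term N + f N ≡ term (suc N)
    last-term (tri< j<N _ _)
      rewrite dec-true (j ℕ.<? N) j<N | dec-true (j ℕ.<? suc N) (<-step j<N)
            | dec-false (P? N) (λ PN → ℕ.<-irrefl (Equivalence.to (P⇔≡j (ℕ.n<1+n N)) PN) j<N)
      = ℤ.+-identityʳ (g j)
    last-term (tri≈ j≮N refl _)
      rewrite dec-false (j ℕ.<? j) j≮N | dec-true (j ℕ.<? suc j) (ℕ.n<1+n j)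
            | dec-true (P? j) (Equivalence.from (P⇔≡j (ℕ.n<1+n j)) refl)
      = ℤ.+-identityˡ (g j)
    last-term (tri> j≮N _ N<j)
      rewrite dec-false (j ℕ.<? N) j≮N | dec-false (j ℕ.<? suc N) (ℕ.<⇒≱ N<j ∘ ℕ.≤-pred)
            | dec-false (P? N) (λ PN → ℕ.<-irrefl (sym (Equivalence.to (P⇔≡j (ℕ.n<1+n N)) PN)) N<j)
      = refl

  coeff-+ₚ : ∀ p q k → coeff (p +ₚ q) k ≡ coeff p k + coeff q k
  coeff-+ₚ []      q       k       = sym (ℤ.+-identityˡ _)
  coeff-+ₚ (a ∷ p) []      k       = sym (ℤ.+-identityʳ _)
  coeff-+ₚ (a ∷ p) (b ∷ q) zero    = refl
  coeff-+ₚ (a ∷ p) (b ∷ q) (suc k) = coeff-+ₚ p q k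

  coeff-scale : ∀ c q k → coeff (scale c q) k ≡ c * coeff q k
  coeff-scale c []      k       = sym (ℤ.*-zeroʳ c)
  coeff-scale c (a ∷ q) zero    = refl
  coeff-scale c (a ∷ q) (suc k) = coeff-scale c q k

  coeff-∷*ₚ : ∀ a p q → coeff ((a ∷ p) *ₚ q) ≗ λ k → a * coeff q k + (x· coeff (p *ₚ q)) k
  coeff-∷*ₚ a p q zero    = trans (coeff-+ₚ (scale a q) _ 0) (cong (_+ 0ℤ) (coeff-scale a q 0))
  coeff-∷*ₚ a p q (suc k) = trans (coeff-+ₚ (scale a q) _ (suc k)) (cong (_+ _) (coeff-scale a q (suc k)))

  coeff-constₚ*ₚ : ∀ c q → coeff (constₚ c *ₚ q) ≗ λ k → c * coeff q k
  coeff-constₚ*ₚ c q k = trans (coeff-∷*ₚ c [] q k) (trans (cong (c * coeff q k +_) (x·-zero k)) (ℤ.+-identityʳ _))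
    where
    x·-zero : ∀ k → (x· coeff []) k ≡ 0ℤ
    x·-zero zero    = refl
    x·-zero (suc k) = refl

  *ₚ-zeroˡ : ∀ p q → p ≈ₚ [] → (p *ₚ q) ≈ₚ []
  *ₚ-zeroˡ []      q p≈0 k = refl
  *ₚ-zeroˡ (a ∷ p) q p≈0 k = begin
    coeff ((a ∷ p) *ₚ q) k                      ≡⟨ coeff-∷*ₚ a p q k ⟩
    a * coeff q k + (x· coeff (p *ₚ q)) k       ≡⟨ cong₂ (λ b g → b * coeff q k + g)
                                                         (p≈0 0) (x·-cong (*ₚ-zeroˡ p q (p≈0 ∘ suc)) k) ⟩
    0ℤ * coeff q k + (x· coeff []) k            ≡⟨ zero-sum k ⟩
    0ℤ                                           ∎
    where
    open ≡-Reasoning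
    zero-sum : ∀ k → 0ℤ * coeff q k + (x· coeff []) k ≡ 0ℤ
    zero-sum zero    = refl
    zero-sum (suc k) = refl

  *ₚ-congˡ : ∀ p p′ q → p ≈ₚ p′ → (p *ₚ q) ≈ₚ (p′ *ₚ q)
  *ₚ-congˡ []      p′       q p≈p′ = sym ∘ *ₚ-zeroˡ p′ q (sym ∘ p≈p′)
  *ₚ-congˡ (a ∷ p) []       q p≈p′ = *ₚ-zeroˡ (a ∷ p) q p≈p′
  *ₚ-congˡ (a ∷ p) (b ∷ p′) q p≈p′ k = begin
    coeff ((a ∷ p) *ₚ q) k                   ≡⟨ coeff-∷*ₚ a p q k ⟩
    a * coeff q k + (x· coeff (p *ₚ q)) k    ≡⟨ cong₂ (λ c g → c * coeff q k + g)
                                                      (p≈p′ 0) (x·-cong (*ₚ-congˡ p p′ q (p≈p′ ∘ suc)) k) ⟩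
    b * coeff q k + (x· coeff (p′ *ₚ q)) k   ≡⟨ coeff-∷*ₚ b p′ q k ⟨
    coeff ((b ∷ p′) *ₚ q) k                  ∎
    where open ≡-Reasoning

  coeff-Xₚ*ₚ : ∀ q → coeff (Xₚ *ₚ q) ≗ x· coeff q
  coeff-Xₚ*ₚ q k = begin
    coeff (Xₚ *ₚ q) k                                    ≡⟨ coeff-∷*ₚ 0ℤ (1ℤ ∷ []) q k ⟩
    0ℤ * coeff q k + (x· coeff (constₚ 1ℤ *ₚ q)) k      ≡⟨ ℤ.+-identityˡ _ ⟩
    (x· coeff (constₚ 1ℤ *ₚ q)) k
      ≡⟨ x·-cong (λ j → trans (coeff-constₚ*ₚ 1ℤ q j) (ℤ.*-identityˡ _)) k ⟩
    (x· coeff q) k                                       ∎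
    where open ≡-Reasoning

  coeff-Xₚ^ : ∀ i → coeff (Xₚ ^ₚ i) ≗ x^ i · δ₀
  coeff-Xₚ^ zero    k = refl
  coeff-Xₚ^ (suc i) k = trans (coeff-Xₚ*ₚ (Xₚ ^ₚ i) k) (x·-cong (coeff-Xₚ^ i) k)

  coeff-Xₚ^*ₚ : ∀ i q → coeff ((Xₚ ^ₚ i) *ₚ q) ≗ x^ i · coeff q
  coeff-Xₚ^*ₚ zero    q k = trans (coeff-constₚ*ₚ 1ℤ q k) (ℤ.*-identityˡ _)
  coeff-Xₚ^*ₚ (suc i) q k = begin
    coeff ((Xₚ *ₚ (Xₚ ^ₚ i)) *ₚ q) k          ≡⟨ *ₚ-congˡ (Xₚ *ₚ (Xₚ ^ₚ i)) (0ℤ ∷ (Xₚ ^ₚ i)) q Xₚ*ₚ≈0∷ k ⟩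
    coeff ((0ℤ ∷ (Xₚ ^ₚ i)) *ₚ q) k           ≡⟨ coeff-∷*ₚ 0ℤ (Xₚ ^ₚ i) q k ⟩
    0ℤ * coeff q k + (x· coeff ((Xₚ ^ₚ i) *ₚ q)) k ≡⟨ ℤ.+-identityˡ _ ⟩
    (x· coeff ((Xₚ ^ₚ i) *ₚ q)) k             ≡⟨ x·-cong (coeff-Xₚ^*ₚ i q) k ⟩
    (x^ suc i · coeff q) k                     ∎
    where
    open ≡-Reasoning
    Xₚ*ₚ≈0∷ : (Xₚ *ₚ (Xₚ ^ₚ i)) ≈ₚ (0ℤ ∷ (Xₚ ^ₚ i))
    Xₚ*ₚ≈0∷ zero    = coeff-Xₚ*ₚ (Xₚ ^ₚ i) zero
    Xₚ*ₚ≈0∷ (suc k) = coeff-Xₚ*ₚ (Xₚ ^ₚ i) (suc k)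

  coeff-[1-x]^ : ∀ j → coeff (oneMinusX ^ₚ j) ≗ [1-x]^ j · δ₀
  coeff-[1-x]^ zero    k = refl
  coeff-[1-x]^ (suc j) k = begin
    coeff (oneMinusX *ₚ R) k                                   ≡⟨ coeff-∷*ₚ 1ℤ (ℤ.-1ℤ ∷ []) R k ⟩
    1ℤ * coeff R k + (x· coeff (constₚ ℤ.-1ℤ *ₚ R)) k
      ≡⟨ cong (1ℤ * coeff R k +_) (x·-cong (coeff-constₚ*ₚ ℤ.-1ℤ R) k) ⟩
    1ℤ * coeff R k + (x· λ k′ → ℤ.-1ℤ * coeff R k′) k          ≡⟨ as-difference k ⟩
    ([1-x]· coeff R) k                                          ≡⟨ [1-x]·-cong (coeff-[1-x]^ j) k ⟩
    ([1-x]^ suc j · δ₀) k                                       ∎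
    where
    open ≡-Reasoning
    R = oneMinusX ^ₚ j
    as-difference : ∀ k → 1ℤ * coeff R k + (x· λ k′ → ℤ.-1ℤ * coeff R k′) k ≡ ([1-x]· coeff R) k
    as-difference zero    = at-zero (coeff R 0)
      where
      at-zero : ∀ c → 1ℤ * c + 0ℤ ≡ c - 0ℤ
      at-zero = solve-∀
    as-difference (suc k) = at-suc (coeff R (suc k)) (coeff R k)
      where
      at-suc : ∀ c d → 1ℤ * c + ℤ.-1ℤ * d ≡ c - d
      at-suc = solve-∀

  coeff-sumₚ : ∀ (F : A → Poly) (xs : List A) k → coeff (sumₚ (map F xs)) k ≡ ∑[ x ∈ xs ] coeff (F x) k
  coeff-sumₚ F []       k = refl
  coeff-sumₚ F (x ∷ xs) k = trans (coeff-+ₚ (F x) _ k) (cong (coeff (F x) k +_) (coeff-sumₚ F xs k))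

  x^-telescope : ∀ m g k → (x^ m · [1-x]· g) k + (x· x^ m · g) k ≡ (x^ m · g) k
  x^-telescope m g k = begin
    (x^ m · [1-x]· g) k + (x· x^ m · g) k              ≡⟨ cong (_+ (x· x^ m · g) k) (x^-linear m g (x· g) k) ⟩
    (x^ m · g) k - (x^ m · x· g) k + (x· x^ m · g) k   ≡⟨ cong (λ a → (x^ m · g) k - a + (x· x^ m · g) k)
                                                              (cong-app (sym (fold-suc g x·_ m)) k) ⟩
    (x^ m · g) k - (x· x^ m · g) k + (x· x^ m · g) k   ≡⟨ minus-plus _ _ ⟩
    (x^ m · g) k                                       ∎
    where
    open ≡-Reasoning
    minus-plus : ∀ a b → a - b + b ≡ a
    minus-plus = solve-∀

  -- Σ_{J ∩ D = ∅} x^(n-|J|) (1-x)^|J| = x^|D| (x + (1-x))^(n-|D|) = x^|D|, as operators on sequences.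
  ∑-avoiding : ∀ n (D : Subset n) g k →
               ∑[ J ∈ allSubsets n ] (if disjoint J D then (x^ (n ∸ ∣ J ∣) · [1-x]^ ∣ J ∣ · g) k else 0ℤ) ≡
               (x^ ∣ D ∣ · g) k
  ∑-avoiding zero    []      g k = ℤ.+-identityʳ _
  ∑-avoiding (suc n) (d ∷ D) g k = begin
    ∑ (map (inside ∷_) L ++ map (outside ∷_) L) F
      ≡⟨ ∑-++ (map (inside ∷_) L) _ F ⟩
    ∑ (map (inside ∷_) L) F + ∑ (map (outside ∷_) L) F
      ≡⟨ cong₂ _+_ (trans (∑-map (inside ∷_) L F) (∑-cong L with-first))
                   (trans (∑-map (outside ∷_) L F) (∑-cong L without-first)) ⟩
    first-in (not d) + ∑[ J ∈ L ] (if disjoint J D then (x· x^ (n ∸ ∣ J ∣) · [1-x]^ ∣ J ∣ · g) k else 0ℤ)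
      ≡⟨ cong (first-in (not d) +_) (trans (∑-x· L (λ J → disjoint J D) _ k) (x·-cong (∑-avoiding n D g) k)) ⟩
    first-in (not d) + (x· x^ ∣ D ∣ · g) k
      ≡⟨ split d ⟩
    (x^ ∣ d ∷ D ∣ · g) k ∎
    where
    open ≡-Reasoning
    L = allSubsets n
    F : Subset (suc n) → ℤ
    F J = if disjoint J (d ∷ D) then (x^ (suc n ∸ ∣ J ∣) · [1-x]^ ∣ J ∣ · g) k else 0ℤ
    first-in : Bool → ℤ
    first-in b = ∑[ J ∈ L ] (if b ∧ disjoint J D then (x^ (n ∸ ∣ J ∣) · [1-x]^ ∣ J ∣ · [1-x]· g) k else 0ℤ)
    with-first : ∀ J → F (inside ∷ J) ≡
                 (if not d ∧ disjoint J D then (x^ (n ∸ ∣ J ∣) · [1-x]^ ∣ J ∣ · [1-x]· g) k else 0ℤ)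
    with-first J = cong (λ h → if not d ∧ disjoint J D then (x^ (n ∸ ∣ J ∣) · h) k else 0ℤ)
                        (fold-suc g [1-x]·_ ∣ J ∣)
    without-first : ∀ J → F (outside ∷ J) ≡
                    (if disjoint J D then (x· x^ (n ∸ ∣ J ∣) · [1-x]^ ∣ J ∣ · g) k else 0ℤ)
    without-first J = cong (λ m → if disjoint J D then (x^ m · [1-x]^ ∣ J ∣ · g) k else 0ℤ)
                           (ℕ.+-∸-assoc 1 (∣p∣≤n J))
    split : ∀ d → first-in (not d) + (x· x^ ∣ D ∣ · g) k ≡ (x^ ∣ d ∷ D ∣ · g) k
    split true  = trans (cong (_+ (x· x^ ∣ D ∣ · g) k) (∑-zero L)) (ℤ.+-identityˡ _)
    split false = trans (cong (_+ (x· x^ ∣ D ∣ · g) k) (∑-avoiding n D ([1-x]· g) k)) (x^-telescope ∣ D ∣ g k)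

-- The parameters other than n only instantiate Construction; hPoly depends on n alone.
module HPolynomialOfCounts (W : Group 0ℓ 0ℓ) (_≈?_ : Decidable (Group._≈_ W)) (n : ℕ)
                           (S : Fin n → Group.Carrier W) (θ : Group.Carrier W → Group.Carrier W)
                           (ℓ : Group.Carrier W → ℕ) where
  open import Data.Integer using (ℤ; 0ℤ; 1ℤ; _+_; _*_)
  open ≡ using (refl; sym; trans; cong; cong₂; module ≡-Reasoning)
  open Construction W _≈?_ n S θ ℓ using (fvec; hPoly)
  open HPolynomial

  term : ℕ → Seq
  term i = x^ i · [1-x]^ (n ∸ i) · δ₀

  face-term : Subset n → Seq
  face-term J = x^ (n ∸ ∣ J ∣) · [1-x]^ ∣ J ∣ · δ₀

  coeff-fvec-term : ∀ comp i k →
                    coeff (constₚ (ℤ.+ fvec comp i) *ₚ ((Xₚ ^ₚ i) *ₚ (oneMinusX ^ₚ (n ∸ i)))) k ≡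
                    ∑[ J ∈ allSubsets n ] (if does (∣ J ∣ ℕ.≟ n ∸ i) then ℤ.+ comp J * term i k else 0ℤ)
  coeff-fvec-term comp i k = begin
    coeff (constₚ (ℤ.+ fvec comp i) *ₚ E) k
      ≡⟨ coeff-constₚ*ₚ (ℤ.+ fvec comp i) E k ⟩
    ℤ.+ fvec comp i * coeff E k
      ≡⟨ cong₂ _*_ (∑-filter (λ J → ∣ J ∣ ℕ.≟ n ∸ i) comp L)
                   (trans (coeff-Xₚ^*ₚ i _ k) (x^-cong i (coeff-[1-x]^ (n ∸ i)) k)) ⟩
    ∑[ J ∈ L ] (if has-dimension J then ℤ.+ comp J else 0ℤ) * term i k
      ≡⟨ ∑-*ʳ L _ (term i k) ⟩
    ∑[ J ∈ L ] ((if has-dimension J then ℤ.+ comp J else 0ℤ) * term i k)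
      ≡⟨ ∑-cong L (λ J → if-*ʳ (has-dimension J) _ (term i k)) ⟩
    ∑[ J ∈ L ] (if has-dimension J then ℤ.+ comp J * term i k else 0ℤ) ∎
    where
    open ≡-Reasoning
    L = allSubsets n
    E = (Xₚ ^ₚ i) *ₚ (oneMinusX ^ₚ (n ∸ i))
    has-dimension : Subset n → Bool
    has-dimension J = does (∣ J ∣ ℕ.≟ n ∸ i)

  ∑-dimension : ∀ c J k → ∑[ i ∈ upTo (suc n) ] (if does (∣ J ∣ ℕ.≟ n ∸ i) then c * term i k else 0ℤ) ≡
                          c * face-term J k
  ∑-dimension c J k = begin
    ∑[ i ∈ upTo (suc n) ] (if does (∣ J ∣ ℕ.≟ n ∸ i) then c * term i k else 0ℤ)
      ≡⟨ ∑-upTo-unique (λ i → c * term i k) (λ i → ∣ J ∣ ℕ.≟ n ∸ i) (n ∸ ∣ J ∣) (suc n)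
                       (λ i<1+n → mk⇔ (λ eq → trans (cong (n ∸_) eq) (ℕ.m∸[m∸n]≡n (ℕ.≤-pred i<1+n)))
                                      (λ eq → trans (sym (ℕ.m∸[m∸n]≡n (∣p∣≤n J))) (cong (n ∸_) eq))) ⟩
    (if does (n ∸ ∣ J ∣ ℕ.<? suc n) then c * term (n ∸ ∣ J ∣) k else 0ℤ)
      ≡⟨ cong (λ b → if b then c * term (n ∸ ∣ J ∣) k else 0ℤ)
              (dec-true (n ∸ ∣ J ∣ ℕ.<? suc n) (ℕ.s≤s (ℕ.m∸n≤m n ∣ J ∣))) ⟩
    c * term (n ∸ ∣ J ∣) k
      ≡⟨ cong (λ m → c * (x^ (n ∸ ∣ J ∣) · [1-x]^ m · δ₀) k) (ℕ.m∸[m∸n]≡n (∣p∣≤n J)) ⟩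
    c * face-term J k ∎
    where open ≡-Reasoning

  coeff-hPoly : ∀ comp k → coeff (hPoly comp) k ≡ ∑[ J ∈ allSubsets n ] (ℤ.+ comp J * face-term J k)
  coeff-hPoly comp k = begin
    coeff (hPoly comp) k
      ≡⟨ coeff-sumₚ (λ i → constₚ (ℤ.+ fvec comp i) *ₚ ((Xₚ ^ₚ i) *ₚ (oneMinusX ^ₚ (n ∸ i)))) U k ⟩
    ∑[ i ∈ U ] coeff (constₚ (ℤ.+ fvec comp i) *ₚ ((Xₚ ^ₚ i) *ₚ (oneMinusX ^ₚ (n ∸ i)))) k
      ≡⟨ ∑-cong U (λ i → coeff-fvec-term comp i k) ⟩
    ∑[ i ∈ U ] ∑[ J ∈ L ] (if does (∣ J ∣ ℕ.≟ n ∸ i) then ℤ.+ comp J * term i k else 0ℤ)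
      ≡⟨ ∑-comm U L _ ⟩
    ∑[ J ∈ L ] ∑[ i ∈ U ] (if does (∣ J ∣ ℕ.≟ n ∸ i) then ℤ.+ comp J * term i k else 0ℤ)
      ≡⟨ ∑-cong L (λ J → ∑-dimension (ℤ.+ comp J) J k) ⟩
    ∑[ J ∈ L ] (ℤ.+ comp J * face-term J k) ∎
    where
    open ≡-Reasoning
    U = upTo (suc n)
    L = allSubsets n

  hPoly-from-avoiding-counts :
    ∀ {A : Set} (I : List A) (D : A → Subset n) (comp : Subset n → ℕ) →
    (∀ J → comp J ≡ length (filter (λ w → T? (disjoint J (D w))) I)) →
    hPoly comp ≈ₚ sumₚ (map (λ w → Xₚ ^ₚ ∣ D w ∣) I)
  hPoly-from-avoiding-counts I D comp comp≡ k = begin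
    coeff (hPoly comp) k
      ≡⟨ coeff-hPoly comp k ⟩
    ∑[ J ∈ L ] (ℤ.+ comp J * face-term J k)
      ≡⟨ ∑-cong L count-as-sum ⟩
    ∑[ J ∈ L ] ∑[ w ∈ I ] (if disjoint J (D w) then face-term J k else 0ℤ)
      ≡⟨ ∑-comm L I _ ⟩
    ∑[ w ∈ I ] ∑[ J ∈ L ] (if disjoint J (D w) then face-term J k else 0ℤ)
      ≡⟨ ∑-cong I (λ w → trans (∑-avoiding n (D w) δ₀ k) (sym (coeff-Xₚ^ ∣ D w ∣ k))) ⟩
    ∑[ w ∈ I ] coeff (Xₚ ^ₚ ∣ D w ∣) k
      ≡⟨ coeff-sumₚ _ I k ⟨
    coeff (sumₚ (map (λ w → Xₚ ^ₚ ∣ D w ∣) I)) k ∎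
    where
    open ≡-Reasoning
    L = allSubsets n
    count-as-sum : ∀ J → ℤ.+ comp J * face-term J k ≡ ∑[ w ∈ I ] (if disjoint J (D w) then face-term J k else 0ℤ)
    count-as-sum J = begin
      ℤ.+ comp J * face-term J k
        ≡⟨ cong (λ c → ℤ.+ c * face-term J k) (comp≡ J) ⟩
      ℤ.+ length (filter (λ w → T? (disjoint J (D w))) I) * face-term J k
        ≡⟨ cong (_* face-term J k) (∑-count (λ w → T? (disjoint J (D w))) I) ⟩
      ∑[ w ∈ I ] (if disjoint J (D w) then 1ℤ else 0ℤ) * face-term J k
        ≡⟨ ∑-*ʳ I _ (face-term J k) ⟩
      ∑[ w ∈ I ] ((if disjoint J (D w) then 1ℤ else 0ℤ) * face-term J k)
        ≡⟨ ∑-cong I (λ w → trans (if-*ʳ (disjoint J (D w)) 1ℤ _)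
                                 (cong (λ a → if disjoint J (D w) then a else 0ℤ) (ℤ.*-identityˡ _))) ⟩
      ∑[ w ∈ I ] (if disjoint J (D w) then face-term J k else 0ℤ) ∎

All-reverse : ∀ {A : Set} {P : Pred A 0ℓ} {xs} → All P xs → All P (reverse xs)
All-reverse {xs = []}     []         = []
All-reverse {xs = x ∷ xs} (Px ∷ Pxs) = ≡.subst (All _) (≡.sym (List.unfold-reverse x xs)) (++⁺ (All-reverse Pxs) (Px ∷ []))

All-delete : ∀ {A : Set} {P : Pred A 0ℓ} xs {y} ys → All P (xs ++ y ∷ ys) → All P (xs ++ ys)
All-delete xs ys P-all with ++⁻ʳ xs P-all
... | _ ∷ P-ys = ++⁺ (++⁻ˡ xs P-all) P-ys

module GroupLemmas (G : Group 0ℓ 0ℓ) where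
  open import Data.Nat using (_+_)
  open Group G
  open import Algebra.Properties.Group G public
  open import Algebra.Properties.Monoid monoid public using (cancelʳ; cancelˡ; cancelᶜ; elimˡ; elimʳ)
  open import Algebra.Solver.Monoid monoid public using (solve; _⊜_) renaming (_⊕_ to infixl 7 _⊛_)
  open import Relation.Binary.Reasoning.Setoid setoid public

  pow-comm : ∀ x m → pow G x m ∙ x ≈ x ∙ pow G x m
  pow-comm x zero    = trans (identityˡ x) (sym (identityʳ x))
  pow-comm x (suc m) = trans (assoc _ _ _) (∙-congˡ (pow-comm x m))

  pow-+ : ∀ x a b → pow G x (a + b) ≈ pow G x a ∙ pow G x b
  pow-+ x zero    b = sym (identityˡ _)
  pow-+ x (suc a) b = trans (∙-congˡ (pow-+ x a b)) (sym (assoc _ _ _))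

  pow-cancel : ∀ {x y} → x ∙ y ≈ ε → ∀ m → pow G x m ∙ pow G y m ≈ ε
  pow-cancel xy≈ε zero    = identityˡ ε
  pow-cancel {x} {y} xy≈ε (suc m) = begin
    x ∙ pow G x m ∙ (y ∙ pow G y m)  ≈⟨ ∙-congʳ (pow-comm x m) ⟨
    pow G x m ∙ x ∙ (y ∙ pow G y m)  ≈⟨ solve 4 (λ a b c d → a ⊛ b ⊛ (c ⊛ d) ⊜ a ⊛ (b ⊛ c) ⊛ d) refl _ x y _ ⟩
    pow G x m ∙ (x ∙ y) ∙ pow G y m  ≈⟨ ∙-congʳ (elimʳ xy≈ε _) ⟩
    pow G x m ∙ pow G y m            ≈⟨ pow-cancel xy≈ε m ⟩
    ε                                ∎

  pow-intertwine : ∀ {a x y} → a ∙ x ≈ y ∙ a → ∀ m → a ∙ pow G x m ≈ pow G y m ∙ a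
  pow-intertwine {a} ax≈ya zero    = trans (identityʳ a) (sym (identityˡ a))
  pow-intertwine {a} {x} {y} ax≈ya (suc m) = begin
    a ∙ (x ∙ pow G x m)   ≈⟨ assoc a x _ ⟨
    a ∙ x ∙ pow G x m     ≈⟨ ∙-congʳ ax≈ya ⟩
    y ∙ a ∙ pow G x m     ≈⟨ assoc y a _ ⟩
    y ∙ (a ∙ pow G x m)   ≈⟨ ∙-congˡ (pow-intertwine ax≈ya m) ⟩
    y ∙ (pow G y m ∙ a)   ≈⟨ assoc y _ a ⟨
    y ∙ pow G y m ∙ a     ∎

  involution⁻¹ : ∀ {s} → s ∙ s ≈ ε → s ⁻¹ ≈ s
  involution⁻¹ {s} ss≈ε = sym (inverseʳ-unique s s ss≈ε)

  conjugate-⇔ : ∀ {g h a t} → g ∙ h ≈ ε → a ≈ g ∙ t ∙ h ⇔ h ∙ a ∙ g ≈ t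
  conjugate-⇔ {g} {h} {a} {t} gh≈ε = mk⇔ to from
    where
    hg≈ε : h ∙ g ≈ ε
    hg≈ε = trans (∙-congʳ (inverseʳ-unique g h gh≈ε)) (inverseˡ g)
    to : a ≈ g ∙ t ∙ h → h ∙ a ∙ g ≈ t
    to a≈gth = begin
      h ∙ a ∙ g              ≈⟨ ∙-congʳ (∙-congˡ a≈gth) ⟩
      h ∙ (g ∙ t ∙ h) ∙ g    ≈⟨ solve 3 (λ g h t → h ⊛ (g ⊛ t ⊛ h) ⊛ g ⊜ (h ⊛ g) ⊛ t ⊛ (h ⊛ g)) refl g h t ⟩
      (h ∙ g) ∙ t ∙ (h ∙ g)  ≈⟨ trans (elimʳ hg≈ε _) (elimˡ hg≈ε t) ⟩
      t                      ∎
    from : h ∙ a ∙ g ≈ t → a ≈ g ∙ t ∙ h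
    from hag≈t = sym (begin
      g ∙ t ∙ h              ≈⟨ ∙-congʳ (∙-congˡ hag≈t) ⟨
      g ∙ (h ∙ a ∙ g) ∙ h    ≈⟨ solve 3 (λ g h a → g ⊛ (h ⊛ a ⊛ g) ⊛ h ⊜ (g ⊛ h) ⊛ a ⊛ (g ⊛ h)) refl g h a ⟩
      (g ∙ h) ∙ a ∙ (g ∙ h)  ≈⟨ trans (elimʳ gh≈ε _) (elimˡ gh≈ε a) ⟩
      a                      ∎)

module Permutations (A : Setoid 0ℓ 0ℓ) where
  open Setoid A

  record Permutation : Set where
    field
      to from   : Carrier → Carrier
      to-cong   : ∀ {x y} → x ≈ y → to x ≈ to y
      from-cong : ∀ {x y} → x ≈ y → from x ≈ from y
      to-from   : ∀ x → to (from x) ≈ x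
      from-to   : ∀ x → from (to x) ≈ x
  open Permutation

  involutionPermutation : (f : Carrier → Carrier) → (∀ {x y} → x ≈ y → f x ≈ f y) → (∀ x → f (f x) ≈ x) →
                          Permutation
  involutionPermutation f f-cong ff≈id = record
    { to = f ; from = f ; to-cong = f-cong ; from-cong = f-cong ; to-from = ff≈id ; from-to = ff≈id }

  Sym : Group 0ℓ 0ℓ
  Sym = record
    { Carrier = Permutation
    ; _≈_     = λ p q → ∀ x → to p x ≈ to q x
    ; _∙_     = _∘ᵖ_
    ; ε       = record { to = λ x → x ; from = λ x → x ; to-cong = λ e → e ; from-cong = λ e → e
                       ; to-from = λ _ → refl ; from-to = λ _ → refl }
    ; _⁻¹     = λ p → record { to = from p ; from = to p ; to-cong = from-cong p ; from-cong = to-cong p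
                             ; to-from = from-to p ; from-to = to-from p }
    ; isGroup = record
      { isMonoid = record
        { isSemigroup = record
          { isMagma = record
            { isEquivalence = record { refl = λ _ → refl ; sym = λ e x → sym (e x)
                                     ; trans = λ e e′ x → trans (e x) (e′ x) }
            ; ∙-cong = λ {p} {_} {_} {q′} p≈p′ q≈q′ x → trans (to-cong p (q≈q′ x)) (p≈p′ (to q′ x)) }
          ; assoc = λ _ _ _ _ → refl }
        ; identity = (λ _ _ → refl) , (λ _ _ → refl) }
      ; inverse = (λ p → from-to p) , (λ p → to-from p)
      ; ⁻¹-cong = λ {p} {q} p≈q x → trans (sym (from-to q (from p x)))
                                           (from-cong q (trans (sym (p≈q (from p x))) (to-from p x))) } }
    where
    _∘ᵖ_ : Permutation → Permutation → Permutation
    p ∘ᵖ q = record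
      { to = λ x → to p (to q x) ; from = λ x → from q (from p x)
      ; to-cong = to-cong p ∘ to-cong q ; from-cong = from-cong q ∘ from-cong p
      ; to-from = λ x → trans (to-cong p (to-from q (from p x))) (to-from p x)
      ; from-to = λ x → trans (from-cong q (from-to p (to q x))) (from-to q x) }

module CoxeterWords (W : Group 0ℓ 0ℓ) (n : ℕ) (S : Fin n → Group.Carrier W) (cox : IsCoxeterSystem W n S) where
  open Group W
  open GroupLemmas W
  open IsCoxeterSystem cox

  Word : Set
  Word = List (Fin n)

  prod : Word → Carrier
  prod = wordProd W S

  S⁻¹≈S : ∀ i → S i ⁻¹ ≈ S i
  S⁻¹≈S i = involution⁻¹ (gen-invol i)

  prod-++ : ∀ u v → prod (u ++ v) ≈ prod u ∙ prod v
  prod-++ []      v = sym (identityˡ _)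
  prod-++ (i ∷ u) v = trans (∙-congˡ (prod-++ u v)) (sym (assoc _ _ _))

  prod-∷ʳ : ∀ u i → prod (u ++ i ∷ []) ≈ prod u ∙ S i
  prod-∷ʳ u i = trans (prod-++ u (i ∷ [])) (∙-congˡ (identityʳ (S i)))

  prod-reverse : ∀ u → prod (reverse u) ≈ prod u ⁻¹
  prod-reverse []      = sym ε⁻¹≈ε
  prod-reverse (i ∷ u) = begin
    prod (reverse (i ∷ u))      ≡⟨ ≡.cong prod (List.unfold-reverse i u) ⟩
    prod (reverse u ++ i ∷ [])  ≈⟨ prod-∷ʳ (reverse u) i ⟩
    prod (reverse u) ∙ S i      ≈⟨ ∙-cong (prod-reverse u) (sym (S⁻¹≈S i)) ⟩
    prod u ⁻¹ ∙ S i ⁻¹          ≈⟨ ⁻¹-anti-homo-∙ (S i) (prod u) ⟨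
    (S i ∙ prod u) ⁻¹           ∎

module ReflectionRepresentation (W : Group 0ℓ 0ℓ) (_≈?_ : Decidable (Group._≈_ W))
                                (n : ℕ) (S : Fin n → Group.Carrier W) (cox : IsCoxeterSystem W n S) where
  open import Data.Nat using (_+_)
  open Group W
  open GroupLemmas W
  open IsCoxeterSystem cox
  open CoxeterWords W n S cox
  open Permutations (setoid ×ₛ ≡.setoid Bool)
  open Permutation
  open Setoid (setoid ×ₛ ≡.setoid Bool) using () renaming (_≈_ to _≈ᵀ_; trans to ≈ᵀ-trans)

  private
    [_≈?_] : Carrier → Carrier → Bool
    [ a ≈? b ] = does (a ≈? b)

    ≈?-⇔ : ∀ {a b c d} → (a ≈ b ⇔ c ≈ d) → [ a ≈? b ] ≡ [ c ≈? d ]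
    ≈?-⇔ {a} {b} {c} {d} a≈b⇔c≈d = does-⇔ a≈b⇔c≈d (a ≈? b) (c ≈? d)

  conjugate-twice : ∀ i t → S i ∙ (S i ∙ t ∙ S i) ∙ S i ≈ t
  conjugate-twice i t = Equivalence.to (conjugate-⇔ (gen-invol i)) refl

  S≈conjugate⇔S≈ : ∀ i t → S i ≈ S i ∙ t ∙ S i ⇔ S i ≈ t
  S≈conjugate⇔S≈ i t = mk⇔
    (λ e → trans (sym (cancelʳ (gen-invol i) (S i))) (Equivalence.to (conjugate-⇔ (gen-invol i)) e))
    (λ e → sym (trans (∙-congʳ (∙-congˡ (sym e))) (cancelʳ (gen-invol i) (S i))))

  -- Tits' permutation representation on W × {±1} (Björner–Brenti, Theorem 1.5.1), with all of W in place
  -- of the reflections.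
  reflect : Fin n → Carrier × Bool → Carrier × Bool
  reflect i (t , b) = S i ∙ t ∙ S i , b xor [ S i ≈? t ]

  π : Fin n → Permutation
  π i = involutionPermutation (reflect i) reflect-cong reflect-involutive
    where
    reflect-cong : ∀ {x y} → x ≈ᵀ y → reflect i x ≈ᵀ reflect i y
    reflect-cong {t , b} {t′ , .b} (t≈t′ , ≡.refl) =
      ∙-congʳ (∙-congˡ t≈t′) , ≡.cong (b xor_) (≈?-⇔ (mk⇔ (λ e → trans e t≈t′) (λ e → trans e (sym t≈t′))))
    reflect-involutive : ∀ x → reflect i (reflect i x) ≈ᵀ x
    reflect-involutive (t , b) =
      conjugate-twice i t ,
      ≡.trans (≡.cong ((b xor [ S i ≈? t ]) xor_) (≈?-⇔ (S≈conjugate⇔S≈ i t)))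
        (≡.trans (xor-assoc b _ _) (≡.trans (≡.cong (b xor_) (xor-same [ S i ≈? t ])) (xor-identityʳ b)))

  open Group Sym using () renaming (_∙_ to _∘π_; _≈_ to _≃_; ε to idπ)

  module DihedralRelation (i j : Fin n) where
    s s′ r q : Carrier
    s  = S i
    s′ = S j
    r  = s ∙ s′
    q  = s′ ∙ s

    r∙q≈ε : r ∙ q ≈ ε
    r∙q≈ε = trans (cancelᶜ (gen-invol j) s s) (gen-invol i)

    q∙r≈ε : q ∙ r ≈ ε
    q∙r≈ε = trans (cancelᶜ (gen-invol i) s′ s′) (gen-invol j)

    s′r^≈q^s′ : ∀ m → s′ ∙ pow W r m ≈ pow W q m ∙ s′
    s′r^≈q^s′ = pow-intertwine (sym (assoc s′ s s′))

    rotated : ℕ → Carrier → Carrier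
    rotated m t = pow W r m ∙ t ∙ pow W q m

    reflection : ℕ → Carrier
    reflection k = pow W q k ∙ s′

    hits : Carrier → ℕ → Bool
    hits t zero    = false
    hits t (suc N) = hits t N xor [ t ≈? reflection N ]

    private
      conjugate-⇔′ : ∀ {g h a t c} → g ∙ h ≈ ε → h ∙ a ∙ g ≈ c → a ≈ g ∙ t ∙ h ⇔ t ≈ c
      conjugate-⇔′ gh≈ε hag≈c = mk⇔
        (λ e → trans (sym (Equivalence.to (conjugate-⇔ gh≈ε) e)) hag≈c)
        (λ e → Equivalence.from (conjugate-⇔ gh≈ε) (trans hag≈c (sym e)))

    hit-even : ∀ m t → [ s′ ≈? rotated m t ] ≡ [ t ≈? reflection (m + m) ]
    hit-even m t = ≈?-⇔ (conjugate-⇔′ (pow-cancel r∙q≈ε m) (begin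
      pow W q m ∙ s′ ∙ pow W r m      ≈⟨ assoc _ _ _ ⟩
      pow W q m ∙ (s′ ∙ pow W r m)    ≈⟨ ∙-congˡ (s′r^≈q^s′ m) ⟩
      pow W q m ∙ (pow W q m ∙ s′)    ≈⟨ assoc _ _ _ ⟨
      pow W q m ∙ pow W q m ∙ s′      ≈⟨ ∙-congʳ (pow-+ q m m) ⟨
      reflection (m + m)              ∎))

    hit-odd : ∀ m t → [ s ≈? s′ ∙ rotated m t ∙ s′ ] ≡ [ t ≈? reflection (suc (m + m)) ]
    hit-odd m t = ≈?-⇔ (mk⇔ (λ e → Equivalence.to conj (trans e regroup))
                            (λ e → trans (Equivalence.from conj e) (sym regroup)))
      where
      g h : Carrier
      g = s′ ∙ pow W r m
      h = pow W q m ∙ s′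
      regroup : s′ ∙ rotated m t ∙ s′ ≈ g ∙ t ∙ h
      regroup = solve 4 (λ s′ a t b → s′ ⊛ (a ⊛ t ⊛ b) ⊛ s′ ⊜ s′ ⊛ a ⊛ t ⊛ (b ⊛ s′)) refl s′ _ t _
      g∙h≈ε : g ∙ h ≈ ε
      g∙h≈ε = trans (cancelᶜ (pow-cancel r∙q≈ε m) s′ s′) (gen-invol j)
      conj : s ≈ g ∙ t ∙ h ⇔ t ≈ reflection (suc (m + m))
      conj = conjugate-⇔′ g∙h≈ε (begin
        pow W q m ∙ s′ ∙ s ∙ (s′ ∙ pow W r m)
          ≈⟨ solve 4 (λ a s′ s b → a ⊛ s′ ⊛ s ⊛ b ⊜ a ⊛ (s′ ⊛ s) ⊛ b) refl _ s′ s _ ⟩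
        pow W q m ∙ q ∙ (s′ ∙ pow W r m)           ≈⟨ ∙-cong (pow-comm q m) (s′r^≈q^s′ m) ⟩
        pow W q (suc m) ∙ (pow W q m ∙ s′)         ≈⟨ assoc _ _ _ ⟨
        pow W q (suc m) ∙ pow W q m ∙ s′           ≈⟨ ∙-congʳ (pow-+ q (suc m) m) ⟨
        reflection (suc (m + m))                    ∎)

    π-pow : ∀ m t b → to (pow Sym (π i ∘π π j) m) (t , b) ≈ᵀ (rotated m t , b xor hits t (m + m))
    π-pow zero    t b = sym (trans (identityʳ _) (identityˡ t)) , ≡.sym (xor-identityʳ b)
    π-pow (suc m) t b = ≈ᵀ-trans
      (to-cong (π i ∘π π j) (π-pow m t b))
      (rotate-step , ≡.trans (≡.cong₂ (λ x y → ((b xor hits t (m + m)) xor x) xor y) (hit-even m t) (hit-odd m t))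
                       (≡.trans (≡.trans (≡.cong (_xor _) (xor-assoc b _ _)) (xor-assoc b _ _))
                                (≡.cong (λ N → b xor hits t (suc N)) (≡.sym (ℕ.+-suc m m)))))
      where
      rotate-step : s ∙ (s′ ∙ rotated m t ∙ s′) ∙ s ≈ rotated (suc m) t
      rotate-step = begin
        s ∙ (s′ ∙ (pow W r m ∙ t ∙ pow W q m) ∙ s′) ∙ s
          ≈⟨ solve 5 (λ s s′ a t b → s ⊛ (s′ ⊛ (a ⊛ t ⊛ b) ⊛ s′) ⊛ s ⊜ s ⊛ s′ ⊛ a ⊛ t ⊛ (b ⊛ (s′ ⊛ s)))
                     refl s s′ _ t _ ⟩
        r ∙ pow W r m ∙ t ∙ (pow W q m ∙ q)
          ≈⟨ ∙-congˡ (pow-comm q m) ⟩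
        rotated (suc m) t ∎

    relation : ∀ K → pow W r K ≈ ε → pow Sym (π i ∘π π j) K ≃ idπ
    relation K r^K≈ε (t , b) = ≈ᵀ-trans (π-pow K t b)
      (trans (∙-cong (elimˡ r^K≈ε t) q^K≈ε) (identityʳ t) ,
       ≡.trans (≡.cong (b xor_) (≡.trans (hits-split K) (xor-same (hits t K)))) (xor-identityʳ b))
      where
      q^K≈ε : pow W q K ≈ ε
      q^K≈ε = trans (sym (elimʳ r^K≈ε _)) (pow-cancel q∙r≈ε K)
      hits-split : ∀ N → hits t (K + N) ≡ hits t K xor hits t N
      hits-split zero    = ≡.trans (≡.cong (hits t) (ℕ.+-identityʳ K)) (≡.sym (xor-identityʳ _))
      hits-split (suc N) = ≡.trans (≡.cong (hits t) (ℕ.+-suc K N))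
        (≡.trans (≡.cong₂ _xor_ (hits-split N) (≈?-⇔ (mk⇔ (λ e → trans e periodic) (λ e → trans e (sym periodic)))))
                 (xor-assoc (hits t K) (hits t N) _))
        where
        periodic : reflection (K + N) ≈ reflection N
        periodic = ∙-congʳ (trans (pow-+ q K N) (elimˡ q^K≈ε _))

  private
    ρ-universal = universal Sym π (λ i j K → DihedralRelation.relation i j K)

  ρ : Carrier → Permutation
  ρ = proj₁ ρ-universal

  private
    open GroupMorphisms.IsGroupHomomorphism (proj₁ (proj₂ ρ-universal))
      using () renaming (homo to ρ-∙; ε-homo to ρ-ε; ⟦⟧-cong to ρ-cong)

    ρ-S : ∀ i → ρ (S i) ≃ π i
    ρ-S = proj₂ (proj₂ ρ-universal)

  parity : Word → Carrier → Bool
  parity []      t = false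
  parity (i ∷ u) t = parity u t xor [ S i ≈? prod u ∙ t ∙ prod u ⁻¹ ]

  ρ-prod : ∀ u t b → to (ρ (prod u)) (t , b) ≈ᵀ (prod u ∙ t ∙ prod u ⁻¹ , b xor parity u t)
  ρ-prod []      t b = ≈ᵀ-trans (ρ-ε (t , b))
                         (sym (trans (∙-cong (identityˡ t) ε⁻¹≈ε) (identityʳ t)) , ≡.sym (xor-identityʳ b))
  ρ-prod (i ∷ u) t b = ≈ᵀ-trans (ρ-∙ (S i) (prod u) (t , b))
    (≈ᵀ-trans (ρ-S i _)
      (≈ᵀ-trans (to-cong (π i) (ρ-prod u t b))
        (conjugate-∷ , xor-assoc b (parity u t) _)))
    where
    p = prod u
    conjugate-∷ : S i ∙ (p ∙ t ∙ p ⁻¹) ∙ S i ≈ S i ∙ p ∙ t ∙ (S i ∙ p) ⁻¹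
    conjugate-∷ = begin
      S i ∙ (p ∙ t ∙ p ⁻¹) ∙ S i
        ≈⟨ solve 4 (λ s p t p′ → s ⊛ (p ⊛ t ⊛ p′) ⊛ s ⊜ s ⊛ p ⊛ t ⊛ (p′ ⊛ s)) refl (S i) p t (p ⁻¹) ⟩
      S i ∙ p ∙ t ∙ (p ⁻¹ ∙ S i)      ≈⟨ ∙-congˡ (∙-congˡ (S⁻¹≈S i)) ⟨
      S i ∙ p ∙ t ∙ (p ⁻¹ ∙ S i ⁻¹)   ≈⟨ ∙-congˡ (⁻¹-anti-homo-∙ (S i) p) ⟨
      S i ∙ p ∙ t ∙ (S i ∙ p) ⁻¹      ∎

  -- Because ν w t is read off the representation ρ, the parity of the deletions turning a word for w into
  -- a word for w t does not depend on the word (ν-prod); this is what yields the exchange condition.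
  ν : Carrier → Carrier → Bool
  ν w t = proj₂ (to (ρ w) (t , false))

  ν-prod : ∀ u {w} t → prod u ≈ w → ν w t ≡ parity u t
  ν-prod u t u≈w = ≡.trans (≡.sym (proj₂ (ρ-cong u≈w (t , false)))) (proj₂ (ρ-prod u t false))

  parity-cong : ∀ u {t t′} → t ≈ t′ → parity u t ≡ parity u t′
  parity-cong []      t≈t′ = ≡.refl
  parity-cong (i ∷ u) t≈t′ = ≡.cong₂ _xor_ (parity-cong u t≈t′)
    (≈?-⇔ (mk⇔ (λ e → trans e (∙-congʳ (∙-congˡ t≈t′))) (λ e → trans e (∙-congʳ (∙-congˡ (sym t≈t′))))))

  parity-++ : ∀ u v t → parity (u ++ v) t ≡ parity v t xor parity u (prod v ∙ t ∙ prod v ⁻¹)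
  parity-++ []      v t = ≡.sym (xor-identityʳ _)
  parity-++ (i ∷ u) v t =
    ≡.trans (≡.cong₂ _xor_ (parity-++ u v t) (≈?-⇔ (mk⇔ (λ e → trans e regroup) (λ e → trans e (sym regroup)))))
            (xor-assoc (parity v t) _ _)
    where
    regroup : prod (u ++ v) ∙ t ∙ prod (u ++ v) ⁻¹ ≈ prod u ∙ (prod v ∙ t ∙ prod v ⁻¹) ∙ prod u ⁻¹
    regroup = begin
      prod (u ++ v) ∙ t ∙ prod (u ++ v) ⁻¹
        ≈⟨ ∙-cong (∙-congʳ (prod-++ u v)) (trans (⁻¹-cong (prod-++ u v)) (⁻¹-anti-homo-∙ _ _)) ⟩
      prod u ∙ prod v ∙ t ∙ (prod v ⁻¹ ∙ prod u ⁻¹)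
        ≈⟨ solve 5 (λ a b t b′ a′ → a ⊛ b ⊛ t ⊛ (b′ ⊛ a′) ⊜ a ⊛ (b ⊛ t ⊛ b′) ⊛ a′) refl _ _ t _ _ ⟩
      prod u ∙ (prod v ∙ t ∙ prod v ⁻¹) ∙ prod u ⁻¹ ∎

  record Deletion (u : Word) (t : Carrier) : Set where
    field
      before  : Word
      letter  : Fin n
      after   : Word
      split   : u ≡ before ++ letter ∷ after
      deletes : prod u ∙ t ≈ prod (before ++ after)

  parity⇒deletion : ∀ u t → parity u t ≡ true → Deletion u t
  parity⇒deletion []      t ()
  parity⇒deletion (j ∷ u) t odd with S j ≈? (prod u ∙ t ∙ prod u ⁻¹)
  ... | yes Sj≈ptp⁻¹ = record { before = [] ; letter = j ; after = u ; split = ≡.refl ; deletes = deletes }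
    where
    p = prod u
    deletes : S j ∙ p ∙ t ≈ p
    deletes = begin
      S j ∙ p ∙ t                 ≈⟨ ∙-congˡ (Equivalence.to (conjugate-⇔ (inverseʳ p)) Sj≈ptp⁻¹) ⟨
      S j ∙ p ∙ (p ⁻¹ ∙ S j ∙ p)
        ≈⟨ solve 3 (λ s p p′ → s ⊛ p ⊛ (p′ ⊛ s ⊛ p) ⊜ s ⊛ (p ⊛ p′) ⊛ s ⊛ p) refl (S j) p (p ⁻¹) ⟩
      S j ∙ (p ∙ p ⁻¹) ∙ S j ∙ p  ≈⟨ ∙-congʳ (trans (∙-congʳ (elimʳ (inverseʳ p) (S j))) (gen-invol j)) ⟩
      ε ∙ p                       ≈⟨ identityˡ p ⟩
      p                           ∎
  ... | no _ = record { before = j ∷ before ; letter = letter ; after = after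
                      ; split = ≡.cong (j ∷_) split ; deletes = trans (assoc _ _ _) (∙-congˡ deletes) }
    where open Deletion (parity⇒deletion u t (≡.trans (≡.sym (xor-identityʳ _)) odd))

  deletion-++ : ∀ u v {t} → Deletion (u ++ v) t → Deletion v t ⊎ Deletion u (prod v ∙ t ∙ prod v ⁻¹)
  deletion-++ []      v d = inj₁ d
  deletion-++ (i ∷ u) v {t} record { before = [] ; letter = .i ; after = .(u ++ v) ; split = ≡.refl ; deletes = deletes } =
    inj₂ (record { before = [] ; letter = i ; after = u ; split = ≡.refl ; deletes = begin
      S i ∙ prod u ∙ (prod v ∙ t ∙ prod v ⁻¹)
        ≈⟨ solve 5 (λ s a b t b′ → s ⊛ a ⊛ (b ⊛ t ⊛ b′) ⊜ s ⊛ (a ⊛ b) ⊛ t ⊛ b′) refl (S i) _ _ t _ ⟩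
      S i ∙ (prod u ∙ prod v) ∙ t ∙ prod v ⁻¹  ≈⟨ ∙-congʳ (∙-congʳ (∙-congˡ (prod-++ u v))) ⟨
      S i ∙ prod (u ++ v) ∙ t ∙ prod v ⁻¹      ≈⟨ ∙-congʳ deletes ⟩
      prod (u ++ v) ∙ prod v ⁻¹                ≈⟨ ∙-congʳ (prod-++ u v) ⟩
      prod u ∙ prod v ∙ prod v ⁻¹              ≈⟨ cancelʳ (inverseʳ (prod v)) (prod u) ⟩
      prod u                                   ∎ })
  deletion-++ (i ∷ u) v {t} record { before = i′ ∷ pre ; letter = j ; after = suf ; split = split ; deletes = deletes }
    with List.∷-injective split
  ... | ≡.refl , split′ with deletion-++ u v (record
        { before = pre ; letter = j ; after = suf ; split = split′
        ; deletes = ∙-cancelˡ (S i) _ _ (trans (sym (assoc _ _ _)) deletes) })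
  ... | inj₁ d = inj₁ d
  ... | inj₂ record { before = pre′ ; letter = k ; after = suf′ ; split = split″ ; deletes = deletes′ } =
    inj₂ (record { before = i ∷ pre′ ; letter = k ; after = suf′ ; split = ≡.cong (i ∷_) split″
                 ; deletes = trans (assoc _ _ _) (∙-congˡ deletes′) })

module Length (W : Group 0ℓ 0ℓ) (_≈?_ : Decidable (Group._≈_ W))
              (n : ℕ) (S : Fin n → Group.Carrier W) (cox : IsCoxeterSystem W n S)
              (ℓ : Group.Carrier W → ℕ) (isLength : IsLengthFunction W n S ℓ) where
  open import Data.Nat using (_+_)
  open Group W
  open GroupLemmas W
  open IsCoxeterSystem cox
  open IsLengthFunction isLength
  open CoxeterWords W n S cox
  open ReflectionRepresentation W _≈?_ n S cox
    using (ν; ν-prod; parity; parity-cong; parity-++; Deletion; parity⇒deletion; deletion-++)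

  ℓ-cong : ∀ {w w′} → w ≈ w′ → ℓ w ≡ ℓ w′
  ℓ-cong {w} {w′} w≈w′ = ℕ.≤-antisym (≤ w≈w′) (≤ (sym w≈w′))
    where
    ≤ : ∀ {x y} → x ≈ y → ℓ x ≤ ℓ y
    ≤ {x} {y} x≈y with attained y
    ... | u , |u|≡ℓy , u≈y = ≡.subst (ℓ x ≤_) |u|≡ℓy (minimal x u (trans u≈y (sym x≈y)))

  ℓ-∙ : ∀ x y → ℓ (x ∙ y) ≤ ℓ x + ℓ y
  ℓ-∙ x y with attained x | attained y
  ... | u , |u|≡ , u≈x | v , |v|≡ , v≈y =
    ≡.subst (ℓ (x ∙ y) ≤_) (≡.trans (List.length-++ u) (≡.cong₂ _+_ |u|≡ |v|≡))
            (minimal _ (u ++ v) (trans (prod-++ u v) (∙-cong u≈x v≈y)))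

  ℓ-S : ∀ i → ℓ (S i) ≤ 1
  ℓ-S i = minimal (S i) (i ∷ []) (identityʳ (S i))

  ℓ-∙S : ∀ w i → ℓ (w ∙ S i) ≤ suc (ℓ w)
  ℓ-∙S w i = ℕ.≤-trans (ℓ-∙ w (S i)) (≡.subst (ℓ w + ℓ (S i) ≤_) (ℕ.+-comm (ℓ w) 1) (ℕ.+-monoʳ-≤ (ℓ w) (ℓ-S i)))

  ℓ-S∙ : ∀ w i → ℓ (S i ∙ w) ≤ suc (ℓ w)
  ℓ-S∙ w i = ℕ.≤-trans (ℓ-∙ (S i) w) (ℕ.+-monoˡ-≤ (ℓ w) (ℓ-S i))

  ℓ-⁻¹ : ∀ w → ℓ (w ⁻¹) ≡ ℓ w
  ℓ-⁻¹ w = ℕ.≤-antisym (ℓ-⁻¹≤ w) (≡.subst (_≤ ℓ (w ⁻¹)) (ℓ-cong (⁻¹-involutive w)) (ℓ-⁻¹≤ (w ⁻¹)))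
    where
    ℓ-⁻¹≤ : ∀ w → ℓ (w ⁻¹) ≤ ℓ w
    ℓ-⁻¹≤ w with attained w
    ... | u , |u|≡ℓw , u≈w = ≡.subst (ℓ (w ⁻¹) ≤_) (≡.trans (List.length-reverse u) |u|≡ℓw)
                                    (minimal _ (reverse u) (trans (prod-reverse u) (⁻¹-cong u≈w)))

  ℓ-S∙≡ℓ-⁻¹∙S : ∀ w i → ℓ (S i ∙ w) ≡ ℓ (w ⁻¹ ∙ S i)
  ℓ-S∙≡ℓ-⁻¹∙S w i = ≡.trans (≡.sym (ℓ-⁻¹ _)) (ℓ-cong (trans (⁻¹-anti-homo-∙ (S i) w) (∙-congˡ (S⁻¹≈S i))))

  length-delete : ∀ pre (j : Fin n) suf → length (pre ++ j ∷ suf) ≡ suc (length (pre ++ suf))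
  length-delete pre j suf = ≡.trans (List.length-++ pre)
    (≡.trans (ℕ.+-suc (length pre) (length suf)) (≡.cong suc (≡.sym (List.length-++ pre))))

  ℓ-deletion : ∀ {u t} (d : Deletion u t) → ℓ (prod u ∙ t) < length u
  ℓ-deletion record { before = pre ; letter = j ; after = suf ; split = ≡.refl ; deletes = deletes } =
    ℕ.≤-<-trans (minimal _ (pre ++ suf) (sym deletes)) (ℕ.≤-reflexive (≡.sym (length-delete pre j suf)))

  ν⇒descent : ∀ w t → ν w t ≡ true → ℓ (w ∙ t) < ℓ w
  ν⇒descent w t νwt with attained w
  ... | u , |u|≡ℓw , u≈w = ≡.subst₂ _<_ (ℓ-cong (∙-congʳ u≈w)) |u|≡ℓw
          (ℓ-deletion (parity⇒deletion u t (≡.trans (≡.sym (ν-prod u t u≈w)) νwt)))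

  ν-∙S : ∀ w i → ν (w ∙ S i) (S i) ≡ not (ν w (S i))
  ν-∙S w i with attained w
  ... | u , _ , u≈w =
    ≡.trans (ν-prod (u ++ i ∷ []) (S i) (trans (prod-∷ʳ u i) (∙-congʳ u≈w)))
    (≡.trans (parity-++ u (i ∷ []) (S i))
    (≡.trans (≡.cong₂ _xor_ (dec-true (S i ≈? _) S≈ε∙S∙ε⁻¹) (parity-cong u [i]∙S∙[i]⁻¹≈S))
             (≡.cong not (≡.sym (ν-prod u (S i) u≈w)))))
    where
    [i]∙S∙[i]⁻¹ : Carrier
    [i]∙S∙[i]⁻¹ = prod (i ∷ []) ∙ S i ∙ prod (i ∷ []) ⁻¹
    [i]∙S∙[i]⁻¹≈S : [i]∙S∙[i]⁻¹ ≈ S i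
    [i]∙S∙[i]⁻¹≈S = trans (∙-cong (∙-congʳ (identityʳ (S i))) (trans (⁻¹-cong (identityʳ (S i))) (S⁻¹≈S i)))
                          (cancelʳ (gen-invol i) (S i))
    S≈ε∙S∙ε⁻¹ : S i ≈ ε ∙ S i ∙ ε ⁻¹
    S≈ε∙S∙ε⁻¹ = sym (trans (∙-cong (identityˡ (S i)) ε⁻¹≈ε) (identityʳ (S i)))

  private
    ν-false⇒ascent : ∀ w i → ν w (S i) ≡ false → ℓ w < ℓ (w ∙ S i)
    ν-false⇒ascent w i νw≡false = ≡.subst (_< ℓ (w ∙ S i)) (ℓ-cong (cancelʳ (gen-invol i) w))
      (ν⇒descent (w ∙ S i) (S i) (≡.trans (ν-∙S w i) (≡.cong not νw≡false)))

  descent-dichotomy : ∀ w i → ℓ (w ∙ S i) < ℓ w ⊎ ℓ w < ℓ (w ∙ S i)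
  descent-dichotomy w i with ν w (S i) in νw
  ... | true  = inj₁ (ν⇒descent w (S i) νw)
  ... | false = inj₂ (ν-false⇒ascent w i νw)

  exchange : ∀ {w i} u → ℓ (w ∙ S i) < ℓ w → prod u ≈ w → Deletion u (S i)
  exchange {w} {i} u descent u≈w = parity⇒deletion u (S i) (≡.trans (≡.sym (ν-prod u (S i) u≈w)) ν≡true)
    where
    ν≡true : ν w (S i) ≡ true
    ν≡true with ν w (S i) in νw
    ... | true  = ≡.refl
    ... | false = ⊥-elim (ℕ.<-asym descent (ν-false⇒ascent w i νw))

  ℓ-ascent : ∀ w i → ℓ w < ℓ (w ∙ S i) → ℓ (w ∙ S i) ≡ suc (ℓ w)
  ℓ-ascent w i ascent = ℕ.≤-antisym (ℓ-∙S w i) ascent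

  ℓ-descent : ∀ w i → ℓ (w ∙ S i) < ℓ w → ℓ w ≡ suc (ℓ (w ∙ S i))
  ℓ-descent w i descent =
    ℕ.≤-antisym (≡.subst (_≤ suc (ℓ (w ∙ S i))) (ℓ-cong (cancelʳ (gen-invol i) w)) (ℓ-∙S (w ∙ S i) i)) descent

  left-descent-dichotomy : ∀ w i → ℓ (S i ∙ w) < ℓ w ⊎ ℓ w < ℓ (S i ∙ w)
  left-descent-dichotomy w i with descent-dichotomy (w ⁻¹) i
  ... | inj₁ lt = inj₁ (≡.subst₂ _<_ (≡.sym (ℓ-S∙≡ℓ-⁻¹∙S w i)) (ℓ-⁻¹ w) lt)
  ... | inj₂ lt = inj₂ (≡.subst₂ _<_ (ℓ-⁻¹ w) (≡.sym (ℓ-S∙≡ℓ-⁻¹∙S w i)) lt)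

  Reduced : Word → Set
  Reduced u = ℓ (prod u) ≡ length u

  reduced-[] : Reduced []
  reduced-[] = ℕ.n≤0⇒n≡0 (minimal ε [] refl)

  reduced-++ : ∀ u v → Reduced (u ++ v) → Reduced u × Reduced v
  reduced-++ u v u++v-reduced = ℕ.≤-antisym ℓu≤ |u|≤ , ℕ.≤-antisym ℓv≤ |v|≤
    where
    ℓu≤ = minimal (prod u) u refl
    ℓv≤ = minimal (prod v) v refl
    |u|+|v|≤ : length u + length v ≤ ℓ (prod u) + ℓ (prod v)
    |u|+|v|≤ = ≡.subst₂ _≤_ (≡.trans u++v-reduced (List.length-++ u)) ≡.refl
                          (≡.subst (_≤ ℓ (prod u) + ℓ (prod v)) (ℓ-cong (sym (prod-++ u v))) (ℓ-∙ (prod u) (prod v)))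
    |u|≤ : length u ≤ ℓ (prod u)
    |u|≤ = ℕ.+-cancelʳ-≤ (length v) _ _ (ℕ.≤-trans |u|+|v|≤ (ℕ.+-monoʳ-≤ (ℓ (prod u)) ℓv≤))
    |v|≤ : length v ≤ ℓ (prod v)
    |v|≤ = ℕ.+-cancelˡ-≤ (length u) _ _ (ℕ.≤-trans |u|+|v|≤ (ℕ.+-monoˡ-≤ (ℓ (prod v)) ℓu≤))

  reduced-factorisation : ∀ u v → Reduced (u ++ v) → ℓ (prod u ∙ prod v) ≡ ℓ (prod u) + ℓ (prod v)
  reduced-factorisation u v u++v-reduced =
    ≡.trans (ℓ-cong (sym (prod-++ u v)))
    (≡.trans u++v-reduced
    (≡.trans (List.length-++ u) (≡.sym (≡.cong₂ _+_ u-reduced v-reduced))))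
    where
    u-reduced = proj₁ (reduced-++ u v u++v-reduced)
    v-reduced = proj₂ (reduced-++ u v u++v-reduced)

  descent-of-right-factor : ∀ a z k → ℓ (a ∙ z) ≡ ℓ a + ℓ z → ℓ (z ∙ S k) < ℓ z → ℓ (a ∙ z ∙ S k) < ℓ (a ∙ z)
  descent-of-right-factor a z k additive descent =
    ℕ.≤-<-trans (≡.subst (_≤ ℓ a + ℓ (z ∙ S k)) (ℓ-cong (sym (assoc a z (S k)))) (ℓ-∙ a (z ∙ S k)))
                (≡.subst (ℓ a + ℓ (z ∙ S k) <_) (≡.sym additive) (ℕ.+-monoʳ-< (ℓ a) descent))

  descent-from-conjugation : ∀ {x} pre j pre′ k → prod (pre ++ j ∷ pre′) ≈ x → Reduced (pre ++ j ∷ pre′) →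
                             prod pre′ ∙ S k ≈ S j ∙ prod pre′ → ℓ (x ∙ S k) < ℓ x
  descent-from-conjugation {x} pre j pre′ k u≈x u-reduced zs≈sz =
    ≡.subst₂ _<_ (ℓ-cong (∙-congʳ u≈x)) (≡.trans (≡.sym u-reduced) (ℓ-cong u≈x))
      (ℓ-deletion (record { before = pre ; letter = j ; after = pre′ ; split = ≡.refl ; deletes = begin
        prod (pre ++ j ∷ pre′) ∙ S k       ≈⟨ ∙-congʳ (prod-++ pre (j ∷ pre′)) ⟩
        prod pre ∙ (S j ∙ z) ∙ S k         ≈⟨ ∙-congʳ (∙-congˡ zs≈sz) ⟨
        prod pre ∙ (z ∙ S k) ∙ S k         ≈⟨ trans (assoc _ _ _) (∙-congˡ (cancelʳ (gen-invol k) z)) ⟩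
        prod pre ∙ z                       ≈⟨ prod-++ pre pre′ ⟨
        prod (pre ++ pre′)                 ∎ }))
    where
    z = prod pre′

  module Parabolic (J : Pred (Fin n) 0ℓ) where

    NoRightDescent : Carrier → Set
    NoRightDescent x = ∀ j → J j → ℓ x < ℓ (x ∙ S j)

    NoRightDescent-resp-≈ : ∀ {x y} → x ≈ y → NoRightDescent x → NoRightDescent y
    NoRightDescent-resp-≈ x≈y x-ascends j Jj = ≡.subst₂ _<_ (ℓ-cong x≈y) (ℓ-cong (∙-congʳ x≈y)) (x-ascends j Jj)

    NoLeftDescent : Carrier → Set
    NoLeftDescent x = ∀ j → J j → ℓ x < ℓ (S j ∙ x)

    record ReducedExpression (w : Carrier) : Set where
      field
        word       : Word
        in-J       : All J word
        reduced    : Reduced word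
        represents : prod word ≈ w

    reduce : ∀ u → All J u → ReducedExpression (prod u)
    reduce u = go (reverseView u)
      where
      go : ∀ {u} → Reverse u → All J u → ReducedExpression (prod u)
      go [] _ = record { word = [] ; in-J = [] ; reduced = reduced-[] ; represents = refl }
      go (u ∶ ru ∶ʳ a) J-u∷a with go ru (++⁻ˡ u J-u∷a) | ++⁻ʳ u J-u∷a
      ... | record { word = d ; in-J = J-d ; reduced = d-reduced ; represents = d≈u } | Ja ∷ []
        with descent-dichotomy (prod d) a
      ... | inj₂ ascent = record
        { word = d ∷ʳ a ; in-J = ++⁺ J-d (Ja ∷ [])
        ; reduced = ≡.trans (ℓ-cong (prod-∷ʳ d a))
                      (≡.trans (ℓ-ascent (prod d) a ascent)
                      (≡.trans (≡.cong suc d-reduced) (≡.sym (≡.trans (List.length-++ d) (ℕ.+-comm (length d) 1)))))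
        ; represents = trans (prod-∷ʳ d a) (trans (∙-congʳ d≈u) (sym (prod-∷ʳ u a))) }
      ... | inj₁ descent = record
        { word = before ++ after ; in-J = All-delete before after (≡.subst (All J) split J-d)
        ; reduced = ℕ.suc-injective (≡.trans (≡.cong suc (ℓ-cong (sym deletes)))
                      (≡.trans (≡.sym (ℓ-descent (prod d) a descent))
                      (≡.trans d-reduced (≡.trans (≡.cong length split) (length-delete before letter after)))))
        ; represents = trans (sym deletes) (trans (∙-congʳ d≈u) (sym (prod-∷ʳ u a))) }
        where open Deletion (exchange d descent refl)

    suffix-no-descent : ∀ {x} pre j pre′ → prod (pre ++ j ∷ pre′) ≈ x → Reduced (pre ++ j ∷ pre′) →
                        NoRightDescent x → NoRightDescent (prod pre′)
    suffix-no-descent {x} pre j pre′ u≈x u-reduced x-ascends k Jk with descent-dichotomy (prod pre′) k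
    ... | inj₂ ascent  = ascent
    ... | inj₁ descent = ⊥-elim (ℕ.<-asym (x-ascends k Jk)
          (≡.subst₂ _<_ (ℓ-cong (∙-congʳ az≈x)) (ℓ-cong az≈x)
                        (descent-of-right-factor (prod (pre ∷ʳ j)) (prod pre′) k additive descent)))
      where
      assoc-word : pre ++ j ∷ pre′ ≡ (pre ∷ʳ j) ++ pre′
      assoc-word = ≡.sym (List.++-assoc pre (j ∷ []) pre′)
      az≈x : prod (pre ∷ʳ j) ∙ prod pre′ ≈ x
      az≈x = trans (sym (prod-++ (pre ∷ʳ j) pre′)) (trans (reflexive (≡.cong prod (≡.sym assoc-word))) u≈x)
      additive = reduced-factorisation (pre ∷ʳ j) pre′ (≡.subst Reduced assoc-word u-reduced)

    Additive : Carrier → Set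
    Additive x = ∀ b → All J b → Reduced b → ℓ (x ∙ prod b) ≡ ℓ x + length b

    conjugate-into-J : ∀ {z j d₀} → Additive z →
                       ℓ (S j ∙ z) ≡ suc (ℓ z) → All J d₀ → S j ∙ z ≈ z ∙ prod d₀ →
                       ∃[ k ] J k × (z ∙ S k ≈ S j ∙ z)
    conjugate-into-J {z} {j} {d₀} additive ℓ-sz J-d₀ sz≈zd₀ =
      single-letter word in-J zd≈sz (ℕ.+-cancelˡ-≡ (ℓ z) (length word) 1 |z|+|d|≡|z|+1)
      where
      open ReducedExpression (reduce d₀ J-d₀)
      zd≈sz : z ∙ prod word ≈ S j ∙ z
      zd≈sz = trans (∙-congˡ represents) (sym sz≈zd₀)
      |z|+|d|≡|z|+1 : ℓ z + length word ≡ ℓ z + 1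
      |z|+|d|≡|z|+1 = ≡.trans (≡.sym (additive word in-J reduced))
                       (≡.trans (ℓ-cong zd≈sz) (≡.trans ℓ-sz (ℕ.+-comm 1 (ℓ z))))
      single-letter : ∀ d → All J d → z ∙ prod d ≈ S j ∙ z → length d ≡ 1 → ∃[ k ] J k × (z ∙ S k ≈ S j ∙ z)
      single-letter (k ∷ []) (Jk ∷ []) zk≈sz _ = k , Jk , trans (∙-congˡ (sym (identityʳ (S k)))) zk≈sz

    suffix-deletion-impossible : ∀ {b a} → Reduced (b ∷ʳ a) → ¬ Deletion b (S a)
    suffix-deletion-impossible {b} {a} b∷a-reduced d = ℕ.<-asym (ℓ-deletion d) (≡.subst (length b <_) ℓ-b∷a ℕ.≤-refl)
      where
      ℓ-b∷a : suc (length b) ≡ ℓ (prod b ∙ S a)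
      ℓ-b∷a = ≡.trans (≡.sym (≡.trans (List.length-++ b) (ℕ.+-comm (length b) 1)))
                      (≡.trans (≡.sym b∷a-reduced) (ℓ-cong (prod-∷ʳ b a)))

    conjugate-by-word : ∀ b a → (prod b ∙ S a ∙ prod b ⁻¹) ⁻¹ ≈ prod (b ++ a ∷ reverse b)
    conjugate-by-word b a = begin
      (prod b ∙ S a ∙ prod b ⁻¹) ⁻¹        ≈⟨ ⁻¹-anti-homo-∙ _ _ ⟩
      prod b ⁻¹ ⁻¹ ∙ (prod b ∙ S a) ⁻¹     ≈⟨ ∙-cong (⁻¹-involutive _) (⁻¹-anti-homo-∙ _ _) ⟩
      prod b ∙ (S a ⁻¹ ∙ prod b ⁻¹)        ≈⟨ ∙-congˡ (∙-cong (S⁻¹≈S a) (sym (prod-reverse b))) ⟩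
      prod b ∙ prod (a ∷ reverse b)        ≈⟨ prod-++ b (a ∷ reverse b) ⟨
      prod (b ++ a ∷ reverse b)            ∎

    -- Deleting the letter s_j of a reduced word p s_j z of x would give s_j z = z (b a b⁻¹) ∈ z W_J. The
    -- shorter z inherits the absence of J-descents, so by induction z W_J is length-additive; this forces
    -- s_j z = z s_k with k ∈ J, and then s_k would be a right descent of x.
    prefix-deletion-impossible : ∀ {x b a} → NoRightDescent x →
                                 (∀ {z} → ℓ z < ℓ x → NoRightDescent z → Additive z) → All J (b ∷ʳ a) →
                                 ∀ u → Reduced u → prod u ≈ x → ¬ Deletion u (prod b ∙ S a ∙ prod b ⁻¹)
    prefix-deletion-impossible {x} {b} {a} x-ascends additive-below J-b∷a u u-reduced u≈x
      record { before = pre ; letter = j ; after = pre′ ; split = ≡.refl ; deletes = deletes }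
      with conjugate-into-J (additive-below ℓz<ℓx (suffix-no-descent pre j pre′ u≈x u-reduced x-ascends))
                            (≡.trans j∷pre′-reduced (≡.cong suc (≡.sym pre′-reduced))) J-d₀ sz≈zd₀
      where
      z = prod pre′
      c = prod b ∙ S a ∙ prod b ⁻¹
      j∷pre′-reduced = proj₂ (reduced-++ pre (j ∷ pre′) u-reduced)
      pre′-reduced = proj₂ (reduced-++ (j ∷ []) pre′ j∷pre′-reduced)
      ℓz<ℓx : ℓ z < ℓ x
      ℓz<ℓx = ≡.subst₂ _<_ (≡.sym pre′-reduced) (≡.trans (≡.sym u-reduced) (ℓ-cong u≈x))
                (ℕ.≤-trans (ℕ.n<1+n (length pre′))
                           (≡.subst (suc (length pre′) ≤_) (≡.sym (List.length-++ pre)) (ℕ.m≤n+m _ (length pre))))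
      J-d₀ : All J (b ++ a ∷ reverse b)
      J-d₀ = ++⁺ (++⁻ˡ b J-b∷a) (All.head (++⁻ʳ b J-b∷a) ∷ All-reverse (++⁻ˡ b J-b∷a))
      szc≈z : S j ∙ z ∙ c ≈ z
      szc≈z = ∙-cancelˡ (prod pre) _ _ (begin
        prod pre ∙ (S j ∙ z ∙ c)
          ≈⟨ solve 4 (λ p s z c → p ⊛ (s ⊛ z ⊛ c) ⊜ p ⊛ (s ⊛ z) ⊛ c) refl (prod pre) (S j) z c ⟩
        prod pre ∙ (S j ∙ z) ∙ c     ≈⟨ ∙-congʳ (prod-++ pre (j ∷ pre′)) ⟨
        prod (pre ++ j ∷ pre′) ∙ c   ≈⟨ deletes ⟩
        prod (pre ++ pre′)           ≈⟨ prod-++ pre pre′ ⟩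
        prod pre ∙ z                 ∎)
      sz≈zd₀ : S j ∙ z ≈ z ∙ prod (b ++ a ∷ reverse b)
      sz≈zd₀ = trans (x≈z//y _ _ _ szc≈z) (∙-congˡ (conjugate-by-word b a))
    ... | k , Jk , zk≈sz = ℕ.<-asym (x-ascends k Jk) (descent-from-conjugation pre j pre′ k u≈x u-reduced zk≈sz)

    ℓ-∙-reduced : ∀ x → NoRightDescent x → Additive x
    ℓ-∙-reduced x = additivity x (ℕ.<-wellFounded (ℓ x))
      where
      additivity : ∀ x → Acc _<_ (ℓ x) → NoRightDescent x → Additive x
      additivity x (acc smaller) x-ascends b = go (reverseView b)
        where
        go : ∀ {b} → Reverse b → All J b → Reduced b → ℓ (x ∙ prod b) ≡ ℓ x + length b
        go [] _ _ = ≡.trans (ℓ-cong (identityʳ x)) (≡.sym (ℕ.+-identityʳ (ℓ x)))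
        go (b ∶ rb ∶ʳ a) J-b∷a b∷a-reduced with descent-dichotomy (x ∙ prod b) a
        ... | inj₂ ascent =
          ≡.trans (ℓ-cong (trans (∙-congˡ (prod-∷ʳ b a)) (sym (assoc x (prod b) (S a)))))
          (≡.trans (ℓ-ascent (x ∙ prod b) a ascent)
          (≡.trans (≡.cong suc (go rb (++⁻ˡ b J-b∷a) (proj₁ (reduced-++ b (a ∷ []) b∷a-reduced))))
          (≡.trans (≡.sym (ℕ.+-suc (ℓ x) (length b)))
                   (≡.cong (ℓ x +_) (≡.sym (≡.trans (List.length-++ b) (ℕ.+-comm (length b) 1)))))))
        ... | inj₁ descent with attained x
        ... | u , |u|≡ℓx , u≈x
          with deletion-++ u b (exchange (u ++ b) descent (trans (prod-++ u b) (∙-congʳ u≈x)))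
        ... | inj₁ d = ⊥-elim (suffix-deletion-impossible b∷a-reduced d)
        ... | inj₂ d = ⊥-elim (prefix-deletion-impossible x-ascends
                                 (λ ℓz<ℓx → additivity _ (smaller ℓz<ℓx)) J-b∷a
                                 u (≡.trans (ℓ-cong u≈x) (≡.sym |u|≡ℓx)) u≈x d)

    ℓ-reduced-∙ : ∀ x → NoLeftDescent x → ∀ a → All J a → Reduced a → ℓ (prod a ∙ x) ≡ length a + ℓ x
    ℓ-reduced-∙ x x-ascends a J-a a-reduced =
      ≡.trans (≡.sym (ℓ-⁻¹ _))
      (≡.trans (ℓ-cong (trans (⁻¹-anti-homo-∙ (prod a) x) (∙-congˡ (sym (prod-reverse a)))))
      (≡.trans (ℓ-∙-reduced (x ⁻¹) x⁻¹-ascends (reverse a) (All-reverse J-a) reverse-reduced)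
      (≡.trans (≡.cong₂ _+_ (ℓ-⁻¹ x) (List.length-reverse a)) (ℕ.+-comm (ℓ x) (length a)))))
      where
      x⁻¹-ascends : NoRightDescent (x ⁻¹)
      x⁻¹-ascends j Jj = ≡.subst₂ _<_ (≡.sym (ℓ-⁻¹ x)) (ℓ-S∙≡ℓ-⁻¹∙S x j) (x-ascends j Jj)
      reverse-reduced : Reduced (reverse a)
      reverse-reduced = ≡.trans (ℓ-cong (prod-reverse a))
                          (≡.trans (ℓ-⁻¹ (prod a)) (≡.trans a-reduced (≡.sym (List.length-reverse a))))

    module _ (J? : U.Decidable J) where

      deodhar : ∀ v → NoRightDescent v → ∀ k → NoRightDescent (S k ∙ v) ⊎ ∃[ j ] J j × (S k ∙ v ≈ v ∙ S j)
      deodhar v v-ascends k with Fin.any? (λ j → J? j ×-dec (ℓ (S k ∙ v ∙ S j) <? ℓ (S k ∙ v)))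
      ... | no ¬descends = inj₁ ascends
        where
        ascends : NoRightDescent (S k ∙ v)
        ascends j Jj with descent-dichotomy (S k ∙ v) j
        ... | inj₁ descent = ⊥-elim (¬descends (j , Jj , descent))
        ... | inj₂ ascent  = ascent
      ... | yes (j , Jj , descent) with left-descent-dichotomy v k
      ...   | inj₁ k-descent = ⊥-elim (ℕ.<-asym (v-ascends j Jj) (ℕ.≤-<-trans (ℕ.≤-trans ℓ-vs≤ descent) k-descent))
        where
        ℓ-vs≤ : ℓ (v ∙ S j) ≤ suc (ℓ (S k ∙ v ∙ S j))
        ℓ-vs≤ = ≡.subst (_≤ suc (ℓ (S k ∙ v ∙ S j)))
                        (ℓ-cong (trans (∙-congˡ (assoc (S k) v (S j))) (cancelˡ (gen-invol k) (v ∙ S j))))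
                        (ℓ-S∙ (S k ∙ v ∙ S j) k)
      ...   | inj₂ _ with attained v
      ...     | u , |u|≡ℓv , u≈v with deletion-++ (k ∷ []) u (exchange (k ∷ u) descent (∙-congˡ u≈v))
      ...       | inj₁ d = ⊥-elim (ℕ.<-asym (v-ascends j Jj)
                            (≡.subst₂ _<_ (ℓ-cong (∙-congʳ u≈v)) |u|≡ℓv (ℓ-deletion d)))
      ...       | inj₂ record { before = [] ; split = ≡.refl ; deletes = k∙c≈ε } = inj₂ (j , Jj , sv≈vs)
        where
        p = prod u
        c = p ∙ S j ∙ p ⁻¹
        s[vs]≈v : S k ∙ (v ∙ S j) ≈ v
        s[vs]≈v = begin
          S k ∙ (v ∙ S j)          ≈⟨ ∙-congˡ (∙-congʳ u≈v) ⟨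
          S k ∙ (p ∙ S j)          ≈⟨ ∙-congˡ (cancelʳ (inverseˡ p) (p ∙ S j)) ⟨
          S k ∙ (c ∙ p)            ≈⟨ assoc (S k) c p ⟨
          S k ∙ c ∙ p              ≈⟨ elimˡ (trans (∙-congʳ (sym (identityʳ (S k)))) k∙c≈ε) p ⟩
          p                        ≈⟨ u≈v ⟩
          v                        ∎
        sv≈vs : S k ∙ v ≈ v ∙ S j
        sv≈vs = trans (∙-congˡ (sym s[vs]≈v)) (cancelˡ (gen-invol k) (v ∙ S j))
      ...       | inj₂ record { before = _ ∷ [] ; split = () }
      ...       | inj₂ record { before = _ ∷ _ ∷ _ ; split = () }

  module DoubleCoset (J K : Pred (Fin n) 0ℓ) (J? : U.Decidable J) where
    private
      module J = Parabolic J
      module K = Parabolic K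

    record Slide (x : Carrier) (a : Word) : Set where
      field
        v         : Carrier
        a′ c      : Word
        v-ascends : J.NoRightDescent v
        K-a′      : All K a′
        J-c       : All J c
        v≈a′x     : v ≈ prod a′ ∙ x
        ax≈vc     : prod a ∙ x ≈ v ∙ prod c

    slide : ∀ x → J.NoRightDescent x → ∀ a → All K a → Slide x a
    slide x x-ascends [] [] = record
      { v = x ; a′ = [] ; c = [] ; v-ascends = x-ascends ; K-a′ = [] ; J-c = []
      ; v≈a′x = sym (identityˡ x) ; ax≈vc = trans (identityˡ x) (sym (identityʳ x)) }
    slide x x-ascends (k ∷ a) (Kk ∷ K-a) with slide x x-ascends a K-a
    ... | record { v = v ; a′ = a′ ; c = c ; v-ascends = v-ascends ; K-a′ = K-a′ ; J-c = J-c
                 ; v≈a′x = v≈a′x ; ax≈vc = ax≈vc }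
      with J.deodhar J? v v-ascends k
    ... | inj₁ kv-ascends = record
      { v = S k ∙ v ; a′ = k ∷ a′ ; c = c ; v-ascends = kv-ascends ; K-a′ = Kk ∷ K-a′ ; J-c = J-c
      ; v≈a′x = trans (∙-congˡ v≈a′x) (sym (assoc _ _ _))
      ; ax≈vc = trans (assoc _ _ _) (trans (∙-congˡ ax≈vc) (sym (assoc _ _ _))) }
    ... | inj₂ (j , Jj , kv≈vj) = record
      { v = v ; a′ = a′ ; c = j ∷ c ; v-ascends = v-ascends ; K-a′ = K-a′ ; J-c = Jj ∷ J-c ; v≈a′x = v≈a′x
      ; ax≈vc = begin
          S k ∙ prod a ∙ x     ≈⟨ assoc _ _ _ ⟩
          S k ∙ (prod a ∙ x)   ≈⟨ ∙-congˡ ax≈vc ⟩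
          S k ∙ (v ∙ prod c)   ≈⟨ assoc _ _ _ ⟨
          S k ∙ v ∙ prod c     ≈⟨ ∙-congʳ kv≈vj ⟩
          v ∙ S j ∙ prod c     ≈⟨ assoc _ _ _ ⟩
          v ∙ prod (j ∷ c)     ∎ }

    double-coset-minimum : ∀ x → J.NoRightDescent x → K.NoLeftDescent x → ∀ a b → All K a → All J b →
                           ∀ {y} → y ≈ prod a ∙ x ∙ prod b → ℓ x ≤ ℓ y × (ℓ y ≡ ℓ x → y ≈ x)
    double-coset-minimum x x-right-ascends x-left-ascends a b K-a J-b {y} y≈axb =
      ≡.subst (ℓ x ≤_) (≡.sym ℓy) (ℕ.m≤m+n (ℓ x) _) , y≈x
      where
      open Slide (slide x x-right-ascends a K-a)
      module A = K.ReducedExpression (K.reduce a′ K-a′)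
      module D = J.ReducedExpression (J.reduce (c ++ b) (++⁺ J-c J-b))
      v≈a″x : v ≈ prod A.word ∙ x
      v≈a″x = trans v≈a′x (∙-congʳ (sym A.represents))
      y≈vd : y ≈ v ∙ prod D.word
      y≈vd = begin
        y                      ≈⟨ y≈axb ⟩
        prod a ∙ x ∙ prod b    ≈⟨ ∙-congʳ ax≈vc ⟩
        v ∙ prod c ∙ prod b    ≈⟨ assoc _ _ _ ⟩
        v ∙ (prod c ∙ prod b)  ≈⟨ ∙-congˡ (trans (sym (prod-++ c b)) (sym D.represents)) ⟩
        v ∙ prod D.word        ∎
      ℓy : ℓ y ≡ ℓ x + (length A.word + length D.word)
      ℓy = ≡.trans (ℓ-cong y≈vd)
           (≡.trans (J.ℓ-∙-reduced v v-ascends D.word D.in-J D.reduced)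
           (≡.trans (≡.cong (_+ length D.word)
                            (≡.trans (ℓ-cong v≈a″x) (K.ℓ-reduced-∙ x x-left-ascends A.word A.in-J A.reduced)))
           (≡.trans (≡.cong (_+ length D.word) (ℕ.+-comm (length A.word) (ℓ x))) (ℕ.+-assoc (ℓ x) _ _))))
      empty : ∀ u → length u ≡ 0 → prod u ≈ ε
      empty [] _ = refl
      y≈x : ℓ y ≡ ℓ x → y ≈ x
      y≈x ℓy≡ℓx = begin
        y                          ≈⟨ y≈vd ⟩
        v ∙ prod D.word            ≈⟨ elimʳ (empty D.word (ℕ.m+n≡0⇒n≡0 (length A.word) no-letters)) v ⟩
        v                          ≈⟨ v≈a″x ⟩
        prod A.word ∙ x            ≈⟨ elimˡ (empty A.word (ℕ.m+n≡0⇒m≡0 (length A.word) no-letters)) x ⟩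
        x                          ∎
        where
        no-letters : length A.word + length D.word ≡ 0
        no-letters = ℕ.+-cancelˡ-≡ (ℓ x) _ 0 (≡.trans (≡.sym ℓy) (≡.trans ℓy≡ℓx (≡.sym (ℕ.+-identityʳ (ℓ x)))))

module TwistedInvolutions (W : Group 0ℓ 0ℓ) (_≈?_ : Decidable (Group._≈_ W))
                          (n : ℕ) (S : Fin n → Group.Carrier W) (cox : IsCoxeterSystem W n S)
                          (ℓ : Group.Carrier W → ℕ) (isLength : IsLengthFunction W n S ℓ)
                          (θ : Group.Carrier W → Group.Carrier W) (θ-aut : IsInvolutiveDiagramAut W n S θ) where
  open Group W
  open GroupLemmas W
  open IsCoxeterSystem cox
  open IsLengthFunction isLength
  open IsInvolutiveDiagramAut θ-aut
  open GroupMorphisms.IsGroupHomomorphism homo using () renaming (homo to θ-∙; ε-homo to θ-ε; ⟦⟧-cong to θ-cong)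
  open CoxeterWords W n S cox
  open ReflectionRepresentation W _≈?_ n S cox using (deletion-++)
  open Length W _≈?_ n S cox ℓ isLength
  open Construction W _≈?_ n S θ ℓ using (InI; act; Edge; Reach; here; step)

  σ : Fin n → Fin n
  σ i = proj₁ (preservesS i)

  θS≈Sσ : ∀ i → θ (S i) ≈ S (σ i)
  θS≈Sσ i = proj₂ (preservesS i)

  θ-prod : ∀ u → θ (prod u) ≈ prod (map σ u)
  θ-prod []      = θ-ε
  θ-prod (i ∷ u) = trans (θ-∙ (S i) (prod u)) (∙-cong (θS≈Sσ i) (θ-prod u))

  ℓ-θ : ∀ w → ℓ (θ w) ≡ ℓ w
  ℓ-θ w = ℕ.≤-antisym (ℓ-θ≤ w) (≡.subst (_≤ ℓ (θ w)) (ℓ-cong (involutive w)) (ℓ-θ≤ (θ w)))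
    where
    ℓ-θ≤ : ∀ w → ℓ (θ w) ≤ ℓ w
    ℓ-θ≤ w with attained w
    ... | u , |u|≡ℓw , u≈w = ≡.subst (ℓ (θ w) ≤_) (≡.trans (List.length-map σ u) |u|≡ℓw)
                                    (minimal _ (map σ u) (trans (sym (θ-prod u)) (θ-cong u≈w)))

  InI-resp-≈ : ∀ {w w′} → w ≈ w′ → InI w → InI w′
  InI-resp-≈ w≈w′ θw≈w⁻¹ = trans (θ-cong (sym w≈w′)) (trans θw≈w⁻¹ (⁻¹-cong w≈w′))

  θS∙θS≈ε : ∀ i → θ (S i) ∙ θ (S i) ≈ ε
  θS∙θS≈ε i = trans (sym (θ-∙ (S i) (S i))) (trans (θ-cong (gen-invol i)) θ-ε)

  ℓ-θS∙ : ∀ {w} i → InI w → ℓ (θ (S i) ∙ w) ≡ ℓ (w ∙ S i)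
  ℓ-θS∙ {w} i θw≈w⁻¹ = ≡.trans (≡.sym (ℓ-⁻¹ _)) (≡.trans (ℓ-cong inverse≈θ) (ℓ-θ _))
    where
    inverse≈θ : (θ (S i) ∙ w) ⁻¹ ≈ θ (w ∙ S i)
    inverse≈θ = begin
      (θ (S i) ∙ w) ⁻¹        ≈⟨ ⁻¹-anti-homo-∙ _ _ ⟩
      w ⁻¹ ∙ θ (S i) ⁻¹       ≈⟨ ∙-cong (sym θw≈w⁻¹) (involution⁻¹ (θS∙θS≈ε i)) ⟩
      θ w ∙ θ (S i)           ≈⟨ θ-∙ w (S i) ⟨
      θ (w ∙ S i)             ∎

  act-InI : ∀ {w} i → InI w → InI (act w i)
  act-InI {w} i θw≈w⁻¹ with (θ (S i) ∙ w ∙ S i) ≈? w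
  ... | yes fixed = begin
    θ (w ∙ S i)              ≈⟨ θ-∙ w (S i) ⟩
    θ w ∙ θ (S i)            ≈⟨ ∙-cong θw≈w⁻¹ (sym (involution⁻¹ (θS∙θS≈ε i))) ⟩
    w ⁻¹ ∙ θ (S i) ⁻¹        ≈⟨ ⁻¹-anti-homo-∙ _ _ ⟨
    (θ (S i) ∙ w) ⁻¹         ≈⟨ ⁻¹-cong (trans (sym (cancelʳ (gen-invol i) _)) (∙-congʳ fixed)) ⟩
    (w ∙ S i) ⁻¹             ∎
  ... | no _ = begin
    θ (θ (S i) ∙ w ∙ S i)            ≈⟨ trans (θ-∙ _ _) (∙-congʳ (θ-∙ _ _)) ⟩
    θ (θ (S i)) ∙ θ w ∙ θ (S i)      ≈⟨ ∙-cong (∙-cong (trans (involutive (S i)) (sym (S⁻¹≈S i))) θw≈w⁻¹)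
                                               (sym (involution⁻¹ (θS∙θS≈ε i))) ⟩
    S i ⁻¹ ∙ w ⁻¹ ∙ θ (S i) ⁻¹       ≈⟨ ∙-congʳ (⁻¹-anti-homo-∙ w (S i)) ⟨
    (w ∙ S i) ⁻¹ ∙ θ (S i) ⁻¹        ≈⟨ ⁻¹-anti-homo-∙ _ _ ⟨
    (θ (S i) ∙ (w ∙ S i)) ⁻¹         ≈⟨ ⁻¹-cong (assoc _ _ _) ⟨
    (θ (S i) ∙ w ∙ S i) ⁻¹           ∎

  act-descent : ∀ {w} i → InI w → ℓ (w ∙ S i) < ℓ w → ℓ (act w i) < ℓ w
  act-descent {w} i θw≈w⁻¹ descent with (θ (S i) ∙ w ∙ S i) ≈? w
  ... | yes _     = descent
  ... | no unfixed with attained (θ (S i) ∙ w)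
  ... | u , |u|≡ℓsw , u≈sw with deletion-++ (σ i ∷ []) u (exchange (σ i ∷ u) descent σu≈w)
    where
    σu≈w : prod (σ i ∷ u) ≈ w
    σu≈w = trans (∙-cong (sym (θS≈Sσ i)) u≈sw) (cancelˡ (θS∙θS≈ε i) w)
  ...   | inj₁ d = ℕ.<-trans (≡.subst₂ _<_ (ℓ-cong (∙-congʳ u≈sw)) (≡.trans |u|≡ℓsw (ℓ-θS∙ i θw≈w⁻¹)) (ℓ-deletion d))
                             descent
  ...   | inj₂ record { before = [] ; split = ≡.refl ; deletes = σc≈ε } = ⊥-elim (unfixed (begin
      θ (S i) ∙ w ∙ S i          ≈⟨ ∙-congʳ u≈sw ⟨
      prod u ∙ S i               ≈⟨ cancelʳ (inverseˡ (prod u)) _ ⟨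
      c ∙ prod u                 ≈⟨ ∙-cong c≈θS u≈sw ⟩
      θ (S i) ∙ (θ (S i) ∙ w)    ≈⟨ cancelˡ (θS∙θS≈ε i) w ⟩
      w                          ∎))
    where
    c = prod u ∙ S i ∙ prod u ⁻¹
    c≈θS : c ≈ θ (S i)
    c≈θS = trans (inverseʳ-unique (S (σ i)) c (trans (∙-congʳ (sym (identityʳ _))) σc≈ε))
                 (trans (involution⁻¹ (gen-invol (σ i))) (sym (θS≈Sσ i)))
  ...   | inj₂ record { before = _ ∷ [] ; split = () }
  ...   | inj₂ record { before = _ ∷ _ ∷ _ ; split = () }

  act-cases : ∀ w i → act w i ≈ w ∙ S i ⊎ act w i ≈ S (σ i) ∙ w ∙ S i
  act-cases w i with (θ (S i) ∙ w ∙ S i) ≈? w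
  ... | yes _ = inj₁ refl
  ... | no _  = inj₂ (∙-congʳ (∙-congʳ (θS≈Sσ i)))

  module Component (J : Subset n) where
    InJ InσJ : Pred (Fin n) 0ℓ
    InJ j = j ∈ J
    InσJ j = ∃[ i ] i ∈ J × σ i ≡ j

    open Parabolic InJ using (NoRightDescent)
    open Parabolic InσJ using () renaming (NoLeftDescent to NoLeftDescentσ)
    open DoubleCoset InJ InσJ (_∈? J) using (double-coset-minimum)

    edge-cases : ∀ {v u} → Edge J v u → ∃[ i ] i ∈ J × (u ≈ v ∙ S i ⊎ u ≈ S (σ i) ∙ v ∙ S i)
    edge-cases {v} {u} (i , i∈J , inj₁ act-v≈u) with act-cases v i
    ... | inj₁ a≈vs  = i , i∈J , inj₁ (trans (sym act-v≈u) a≈vs)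
    ... | inj₂ a≈svs = i , i∈J , inj₂ (trans (sym act-v≈u) a≈svs)
    edge-cases {v} {u} (i , i∈J , inj₂ act-u≈v) with act-cases u i
    ... | inj₁ a≈us  = i , i∈J , inj₁ (trans (sym (cancelʳ (gen-invol i) u)) (∙-congʳ (trans (sym a≈us) act-u≈v)))
    ... | inj₂ a≈sus = i , i∈J , inj₂ (begin
      u                                   ≈⟨ conjugate-twice ⟨
      S (σ i) ∙ (S (σ i) ∙ u ∙ S i) ∙ S i ≈⟨ ∙-congʳ (∙-congˡ (trans (sym a≈sus) act-u≈v)) ⟩
      S (σ i) ∙ v ∙ S i                   ∎)
      where
      conjugate-twice : S (σ i) ∙ (S (σ i) ∙ u ∙ S i) ∙ S i ≈ u
      conjugate-twice = trans (solve 3 (λ a u b → a ⊛ (a ⊛ u ⊛ b) ⊛ b ⊜ (a ⊛ a) ⊛ u ⊛ (b ⊛ b)) refl (S (σ i)) u (S i))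
                              (trans (elimʳ (gen-invol i) _) (elimˡ (gen-invol (σ i)) u))

    reach⇒double-coset : ∀ {v u} → Reach J v u →
                         ∃[ a ] ∃[ b ] All InσJ a × All InJ b × (u ≈ prod a ∙ v ∙ prod b)
    reach⇒double-coset {v} (here v≈u) = [] , [] , [] , [] , trans (sym v≈u) (sym (trans (identityʳ _) (identityˡ v)))
    reach⇒double-coset {v} {u} (step {u = v′} edge reach) with reach⇒double-coset reach | edge-cases edge
    ... | a , b , σJ-a , J-b , u≈av′b | i , i∈J , inj₁ v′≈vs = a , i ∷ b , σJ-a , i∈J ∷ J-b , (begin
      u                              ≈⟨ u≈av′b ⟩
      prod a ∙ v′ ∙ prod b           ≈⟨ ∙-congʳ (∙-congˡ v′≈vs) ⟩
      prod a ∙ (v ∙ S i) ∙ prod b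
        ≈⟨ solve 4 (λ a v s b → a ⊛ (v ⊛ s) ⊛ b ⊜ a ⊛ v ⊛ (s ⊛ b)) refl (prod a) v (S i) (prod b) ⟩
      prod a ∙ v ∙ prod (i ∷ b)      ∎)
    ... | a , b , σJ-a , J-b , u≈av′b | i , i∈J , inj₂ v′≈svs =
      a ∷ʳ σ i , i ∷ b , ++⁺ σJ-a ((i , i∈J , ≡.refl) ∷ []) , i∈J ∷ J-b , (begin
      u                                      ≈⟨ u≈av′b ⟩
      prod a ∙ v′ ∙ prod b                   ≈⟨ ∙-congʳ (∙-congˡ v′≈svs) ⟩
      prod a ∙ (S (σ i) ∙ v ∙ S i) ∙ prod b  ≈⟨ solve 5 (λ a t v s b → a ⊛ (t ⊛ v ⊛ s) ⊛ b ⊜ a ⊛ t ⊛ v ⊛ (s ⊛ b))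
                                                        refl (prod a) (S (σ i)) v (S i) (prod b) ⟩
      prod a ∙ S (σ i) ∙ v ∙ prod (i ∷ b)    ≈⟨ ∙-congʳ (∙-congʳ (prod-∷ʳ a (σ i))) ⟨
      prod (a ∷ʳ σ i) ∙ v ∙ prod (i ∷ b)     ∎)

    no-left-descent : ∀ {x} → InI x → NoRightDescent x → NoLeftDescentσ x
    no-left-descent {x} θx≈x⁻¹ x-ascends _ (i , i∈J , ≡.refl) =
      ≡.subst (ℓ x <_) (≡.trans (≡.sym (ℓ-θS∙ i θx≈x⁻¹)) (ℓ-cong (∙-congʳ (θS≈Sσ i)))) (x-ascends i i∈J)

    minimal-unique : ∀ {u v} → InI u → InI v → NoRightDescent u → NoRightDescent v → Reach J u v → Reach J v u → u ≈ v
    minimal-unique {u} {v} θu≈u⁻¹ θv≈v⁻¹ u-ascends v-ascends u~v v~u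
      with reach⇒double-coset u~v | reach⇒double-coset v~u
    ... | a , b , σJ-a , J-b , v≈aub | a′ , b′ , σJ-a′ , J-b′ , u≈a′vb′ =
      sym (proj₂ u-minimum (ℕ.≤-antisym (proj₁ v-minimum) (proj₁ u-minimum)))
      where
      u-minimum = double-coset-minimum u u-ascends (no-left-descent θu≈u⁻¹ u-ascends) a b σJ-a J-b v≈aub
      v-minimum = double-coset-minimum v v-ascends (no-left-descent θv≈v⁻¹ v-ascends) a′ b′ σJ-a′ J-b′ u≈a′vb′

    descend : ∀ {v} → InI v → ∃[ u ] InI u × NoRightDescent u × Reach J v u
    descend {v} = go v (ℕ.<-wellFounded (ℓ v))
      where
      go : ∀ v → Acc _<_ (ℓ v) → InI v → ∃[ u ] InI u × NoRightDescent u × Reach J v u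
      go v (acc smaller) θv≈v⁻¹ with Fin.any? (λ j → j ∈? J ×-dec (ℓ (v ∙ S j) <? ℓ v))
      ... | no ¬descends = v , θv≈v⁻¹ , ascends , here refl
        where
        ascends : NoRightDescent v
        ascends j j∈J with descent-dichotomy v j
        ... | inj₁ descent = ⊥-elim (¬descends (j , j∈J , descent))
        ... | inj₂ ascent  = ascent
      ... | yes (j , j∈J , descent) with go (act v j) (smaller (act-descent j θv≈v⁻¹ descent)) (act-InI j θv≈v⁻¹)
      ...   | u , θu≈u⁻¹ , u-ascends , av~u = u , θu≈u⁻¹ , u-ascends , step (j , j∈J , inj₁ refl) av~u

disjoint-tabulate : ∀ {m} (J : Subset m) (f : Fin m → Bool) →
                    T (disjoint J (Vec.tabulate f)) ⇔ (∀ j → j ∈ J → f j ≡ false)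
disjoint-tabulate []            f = mk⇔ (λ _ ()) (λ _ → tt)
disjoint-tabulate (outside ∷ J) f = mk⇔
  (λ disj → λ { (suc j) (there j∈J) → Equivalence.to (disjoint-tabulate J (f ∘ suc)) disj j j∈J })
  (λ avoid → Equivalence.from (disjoint-tabulate J (f ∘ suc)) (λ j j∈J → avoid (suc j) (there j∈J)))
disjoint-tabulate (inside ∷ J) f with f zero in f0
... | true  = mk⇔ (λ ()) (λ avoid → contradiction (≡.trans (≡.sym f0) (avoid zero here)) λ ())
... | false = mk⇔
  (λ { disj zero here → f0 ; disj (suc j) (there j∈J) → Equivalence.to (disjoint-tabulate J (f ∘ suc)) disj j j∈J })
  (λ avoid → Equivalence.from (disjoint-tabulate J (f ∘ suc)) (λ j j∈J → avoid (suc j) (there j∈J)))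

length-filter-tabulate : ∀ {A : Set} {P : Pred A 0ℓ} (P? : U.Decidable P) {m} (g : Fin m → A) →
                         length (filter P? (tabulate g)) ≡ ∣ Vec.tabulate (does ∘ P? ∘ g) ∣
length-filter-tabulate P? {ℕ.zero}  g = ≡.refl
length-filter-tabulate P? {ℕ.suc m} g with does (P? (g zero))
... | true  = ≡.cong ℕ.suc (length-filter-tabulate P? (g ∘ suc))
... | false = length-filter-tabulate P? (g ∘ suc)

AllPairs-lookup : ∀ {A : Set} {R : A → A → Set} {xs : List A} → AllPairs R xs →
                  ∀ {i j} → i <ᶠ j → R (lookup xs i) (lookup xs j)
AllPairs-lookup (Rx ∷ _)  {zero}  {suc j} _         = All.lookup Rx (Mem.∈-lookup j)
AllPairs-lookup (_ ∷ Rxs) {suc i} {suc j} (s≤s i<j) = AllPairs-lookup Rxs i<j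

enumeration-length : ∀ {A : Set} {_≈_ : A → A → Set} {c} (xs : List A) (φ : A → Fin c) →
                     AllPairs (λ x y → ¬ x ≈ y) xs → (∀ {x y} → x ∈ₗ xs → y ∈ₗ xs → φ x ≡ φ y → x ≈ y) →
                     (∀ k → ∃[ x ] x ∈ₗ xs × φ x ≡ k) → length xs ≡ c
enumeration-length {c = c} xs φ distinct injective onto = ℕ.≤-antisym (ℕ.≮⇒≥ too-long) (ℕ.≮⇒≥ too-short)
  where
  too-long : ¬ c < length xs
  too-long c<|xs| with Fin.pigeonhole c<|xs| (φ ∘ lookup xs)
  ... | i , j , i<j , φi≡φj = AllPairs-lookup distinct i<j (injective (Mem.∈-lookup i) (Mem.∈-lookup j) φi≡φj)
  index : Fin c → Fin (length xs)
  index k = Any.index (proj₁ (proj₂ (onto k)))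
  φ∘lookup∘index : ∀ k → φ (lookup xs (index k)) ≡ k
  φ∘lookup∘index k with onto k
  ... | x , x∈xs , φx≡k = ≡.trans (≡.cong φ (≡.sym (Any.lookup-index x∈xs))) φx≡k
  too-short : ¬ length xs < c
  too-short |xs|<c with Fin.pigeonhole |xs|<c index
  ... | k , k′ , k<k′ , same-index = ℕ.<-irrefl (≡.cong toℕ k≡k′) k<k′
    where
    k≡k′ = ≡.trans (≡.sym (φ∘lookup∘index k)) (≡.trans (≡.cong (φ ∘ lookup xs) same-index) (φ∘lookup∘index k′))

module ComponentCounts (W : Group 0ℓ 0ℓ) (_≈?_ : Decidable (Group._≈_ W))
                       (elems : List (Group.Carrier W)) (enum : IsFiniteEnum W elems)
                       (n : ℕ) (S : Fin n → Group.Carrier W) (cox : IsCoxeterSystem W n S)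
                       (ℓ : Group.Carrier W → ℕ) (isLength : IsLengthFunction W n S ℓ)
                       (θ : Group.Carrier W → Group.Carrier W) (θ-aut : IsInvolutiveDiagramAut W n S θ) where
  open Group W
  open IsFiniteEnum enum
  open Construction W _≈?_ n S θ ℓ using (InI; Reach; here; IsComponentCount; descents)
  open Length W _≈?_ n S cox ℓ isLength using (ℓ-cong; descent-dichotomy; module Parabolic)
  open TwistedInvolutions W _≈?_ n S cox ℓ isLength θ θ-aut using (InI-resp-≈; module Component)

  descentSet : Carrier → Subset n
  descentSet w = Vec.tabulate (λ i → does (ℓ (w ∙ S i) <? ℓ w))

  descents≡∣descentSet∣ : ∀ w → descents w ≡ ∣ descentSet w ∣
  descents≡∣descentSet∣ w = length-filter-tabulate (λ i → ℓ (w ∙ S i) <? ℓ w) (λ i → i)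

  twistedInvolutions : List Carrier
  twistedInvolutions = filter (λ w → θ w ≈? (w ⁻¹)) elems

  module _ (J : Subset n) where
    open Parabolic (_∈ J) using (NoRightDescent; NoRightDescent-resp-≈)
    open Component J using (minimal-unique; descend)

    disjoint⇔no-descent : ∀ w → T (disjoint J (descentSet w)) ⇔ NoRightDescent w
    disjoint⇔no-descent w = mk⇔
      (λ disj j j∈J → ascent (Equivalence.to (disjoint-tabulate J _) disj j j∈J))
      (λ ascends → Equivalence.from (disjoint-tabulate J _)
                     (λ j j∈J → dec-false (ℓ (w ∙ S j) <? ℓ w) (ℕ.<-asym (ascends j j∈J))))
      where
      ascent : ∀ {j} → does (ℓ (w ∙ S j) <? ℓ w) ≡ false → ℓ w < ℓ (w ∙ S j)
      ascent {j} not-descent with descent-dichotomy w j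
      ... | inj₁ descent = contradiction (≡.trans (≡.sym (dec-true (ℓ (w ∙ S j) <? ℓ w) descent)) not-descent) λ ()
      ... | inj₂ ascent  = ascent

    minimalElements : List Carrier
    minimalElements = filter (λ w → T? (disjoint J (descentSet w))) twistedInvolutions

    minimal-member : ∀ {w} → w ∈ₗ minimalElements → InI w × NoRightDescent w
    minimal-member w∈ with Mem.∈-filter⁻ (λ w → T? (disjoint J (descentSet w))) {xs = twistedInvolutions} w∈
    ... | w∈I , disj =
      proj₂ (Mem.∈-filter⁻ (λ w → θ w ≈? (w ⁻¹)) {xs = elems} w∈I) , Equivalence.to (disjoint⇔no-descent _) disj

    component-count : ∀ {c} → IsComponentCount J c → c ≡ length minimalElements
    component-count {c} (φ , same-component , onto) =
      ≡.sym (enumeration-length minimalElements φ distinct′ injective onto′)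
      where
      distinct′ : AllPairs (λ x y → ¬ x ≈ y) minimalElements
      distinct′ = AllPairs.filter⁺ _ (AllPairs.filter⁺ _ distinct)
      injective : ∀ {x y} → x ∈ₗ minimalElements → y ∈ₗ minimalElements → φ x ≡ φ y → x ≈ y
      injective x∈ y∈ φx≡φy with minimal-member x∈ | minimal-member y∈
      ... | θx , x-asc | θy , y-asc = minimal-unique θx θy x-asc y-asc
        (Equivalence.to (same-component _ _ θx θy) φx≡φy)
        (Equivalence.to (same-component _ _ θy θx) (≡.sym φx≡φy))
      onto′ : ∀ k → ∃[ x ] x ∈ₗ minimalElements × φ x ≡ k
      onto′ k with onto k
      ... | v , θv , φv≡k with descend θv
      ... | u , θu , u-asc , v~u with Mem.find (complete u)
      ... | e , e∈elems , u≈e = e , e∈ , ≡.trans φe≡φu (≡.trans (≡.sym φv≡φu) φv≡k)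
        where
        θe = InI-resp-≈ u≈e θu
        e∈ : e ∈ₗ minimalElements
        e∈ = Mem.∈-filter⁺ (λ w → T? (disjoint J (descentSet w)))
                           (Mem.∈-filter⁺ (λ w → θ w ≈? (w ⁻¹)) e∈elems θe)
                           (Equivalence.from (disjoint⇔no-descent e) (NoRightDescent-resp-≈ u≈e u-asc))
        φe≡φu = Equivalence.from (same-component e u θe θu) (here (sym u≈e))
        φv≡φu = Equivalence.from (same-component v u θv θu) v~u

theorem5p10 : (W : Group 0ℓ 0ℓ) (_≈?_ : Decidable (Group._≈_ W))
              (elems : List (Group.Carrier W)) → IsFiniteEnum W elems →
              (n : ℕ) (S : Fin n → Group.Carrier W) → IsCoxeterSystem W n S →
              (ℓ : Group.Carrier W → ℕ) → IsLengthFunction W n S ℓ →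
              (θ : Group.Carrier W → Group.Carrier W) → IsInvolutiveDiagramAut W n S θ →
              (comp : Subset n → ℕ) →
              (∀ J → Construction.IsComponentCount W _≈?_ n S θ ℓ J (comp J)) →
              Construction.hPoly W _≈?_ n S θ ℓ comp ≈ₚ Construction.desPoly W _≈?_ n S θ ℓ elems
theorem5p10 W _≈?_ elems enum n S cox ℓ isLength θ θ-aut comp counts k =
  ≡.trans (hPoly-from-avoiding-counts twistedInvolutions descentSet comp (λ J → component-count J (counts J)) k)
          (≡.cong (λ ps → coeff (sumₚ ps) k)
                  (List.map-cong (λ w → ≡.cong (Xₚ ^ₚ_) (≡.sym (descents≡∣descentSet∣ w))) twistedInvolutions))
  where
  open ComponentCounts W _≈?_ elems enum n S cox ℓ isLength θ θ-aut
  open HPolynomialOfCounts W _≈?_ n S θ ℓ
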